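{- For $n\ge1$, $$R_n(x;q)=\sum_{\pi\in\mathfrak{S}_n}x^{{\rm crun}(\pi)}q^{{\rm cyc}(\pi)}.$$
   Context: $R_{n,k}(q)$ are defined by $R_{0,0}(q)=1$, $R_{0,k}(q)=0$ for $k\ne0$, $R_{n,k}(q)=0$ for $k<0$, and $R_{n+1,k}(q)=kR_{n,k}(q)+qR_{n,k-1}(q)+(n-k+2)R_{n,k-2}(q)$; $R_n(x;q)=\sum_kR_{n,k}(q)x^k$. A cycle $w$ on a finite set $A$ of positive integers is written in canonical form $w=y_1y_2\cdots y_k$ with $y_1=\min A$ and $y_i=w^{i-1}(y_1)$. Its number of cycle runs ${\rm crun}(w)$ is the number of alternating runs (maximal consecutive increasing or decreasing subsequences) of the word $y_1y_2\cdots y_k\infty$ (so a fixed point has ${\rm crun}=1$; in general ${\rm crun}(w)=2\,{\rm cpk}(w)+1$ where ${\rm cpk}(w)$ counts $i\in\{2,\dots,k\}$ with $y_{i-1}<y_i>y_{i+1}$, $y_{k+1}=\infty$). For $\pi\in\mathfrak{S}_n$ with cycle decomposition $\pi=w_1\cdots w_m$, ${\rm crun}(\pi)=\sum_i{\rm crun}(w_i)$ and ${\rm cyc}(\pi)=m$ is the number of cycles. -}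

module Defs where

open import Data.Nat as ℕ using (ℕ; zero; suc; _<ᵇ_; _≤ᵇ_)
open import Data.Integer as ℤ using (ℤ; +_)
import Data.Bool
open import Data.Bool using (Bool; true; false; if_then_else_; _xor_; _∧_)
open import Data.Fin using (Fin; toℕ)
open import Data.Fin.Properties using (_≟_)
open import Data.List using (List; []; _∷_; [_]; _++_; map; concatMap; filter; allFin; length; foldr)
open import Data.Nat.ListAction using (sum)
import Data.Vec
open import Data.Vec using (Vec; lookup; toList)
import Data.List.Relation.Unary.Unique.DecPropositional as UniqueDec

-- The polynomials R_{n,k}(q), stored by coefficients:
--   R n k j = coefficient of q^j in R_{n,k}(q)   (an integer).

mutual
  R : ℕ → ℕ → ℕ → ℤ
  R zero zero zero = + 1
  R zero zero (suc j) = + 0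
  R zero (suc k) j = + 0
  R (suc n) k j = (+ k) ℤ.* R n k j ℤ.+ qTerm n k j ℤ.+ lastTerm n k j

  -- coefficient of q^j in q·R_{n,k-1}(q)  (zero if k-1 < 0)
  qTerm : ℕ → ℕ → ℕ → ℤ
  qTerm n zero j = + 0
  qTerm n (suc k) zero = + 0
  qTerm n (suc k) (suc j) = R n k j

  lastTerm : ℕ → ℕ → ℕ → ℤ
  lastTerm n zero j = + 0
  lastTerm n (suc zero) j = + 0
  lastTerm n (suc (suc k)) j = ((+ n) ℤ.- (+ suc (suc k)) ℤ.+ (+ 2)) ℤ.* R n k j

-- The symmetric group S_n: permutations of [n] = Fin n, represented in
-- one-line notation as words of length n over Fin n with distinct letters;
-- π(i) = lookup v i.

allWords : (n m : ℕ) → List (Vec (Fin m) n)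
allWords zero m = Data.Vec.[] ∷ []
allWords (suc n) m = concatMap (λ i → map (i Data.Vec.∷_) (allWords n m)) (allFin m)

Perm : ℕ → Set
Perm n = Vec (Fin n) n

perms : (n : ℕ) → List (Perm n)
perms n = filter (λ v → UniqueDec.unique? (_≟_ {n}) (toList v)) (allWords n n)

app : {n : ℕ} → Perm n → Fin n → Fin n
app v i = lookup v i

_==_ : {n : ℕ} → Fin n → Fin n → Bool
i == j = toℕ i ℕ.≡ᵇ toℕ j

-- orbit word y1 y2 ... yk of the cycle through i, starting at i
-- (fuel n is enough since every cycle has length ≤ n)
orbitFrom : {n : ℕ} → Perm n → Fin n → ℕ → Fin n → List (Fin n)
orbitFrom v i zero x = []
orbitFrom v i (suc f) x = if x == i then [] else x ∷ orbitFrom v i f (app v x)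

orbit : {n : ℕ} → Perm n → Fin n → List (Fin n)
orbit {n} v i = i ∷ orbitFrom v i n (app v i)

isCycleMin : {n : ℕ} → Perm n → Fin n → Bool
isCycleMin v i = foldr (λ y b → (toℕ i ≤ᵇ toℕ y) ∧ b) true (orbit v i)

cycleMins : {n : ℕ} → Perm n → List (Fin n)
cycleMins {n} v = filter (λ i → Data.Bool._≟_ (isCycleMin v i) true) (allFin n)

cyc : {n : ℕ} → Perm n → ℕ
cyc v = length (cycleMins v)

turns : List ℕ → ℕ
turns (a ∷ b ∷ c ∷ rest) = (if (a <ᵇ b) xor (b <ᵇ c) then 1 else 0) ℕ.+ turns (b ∷ c ∷ rest)
turns _ = 0

altRuns : List ℕ → ℕ
altRuns [] = 0
altRuns (a ∷ []) = 1
altRuns (a ∷ b ∷ rest) = suc (turns (a ∷ b ∷ rest))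

-- crun of the cycle with minimum i: alternating runs of y1 ... yk ∞,
-- where ∞ is represented by n (larger than every element of Fin n).
crunCycle : {n : ℕ} → Perm n → Fin n → ℕ
crunCycle {n} v i = altRuns (map toℕ (orbit v i) ++ [ n ])

crun : {n : ℕ} → Perm n → ℕ
crun v = sum (map (crunCycle v) (cycleMins v))

countPerms : ℕ → ℕ → ℕ → ℕ
countPerms n k j =
  length (filter (λ v → Data.Bool._≟_ ((crun v ℕ.≡ᵇ k) ∧ (cyc v ℕ.≡ᵇ j)) true) (perms n))

-- Write c(n,k,j) = #{π ∈ S_n : crun π = k, cyc π = j}.  We show that c obeys
-- the recurrence defining R,
--   c(n+1,k,j) = k·c(n,k,j) + c(n,k-1,j-1) + (n-k+2)·c(n,k-2,j),
-- by building every π ∈ S_{n+1} uniquely from some σ ∈ S_n and a position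
-- y ∈ [n+1]: for y = n+1 the new letter n+1 becomes a fixed point (one more
-- cycle and one more run), and for y ∈ [n] it is inserted right after y in
-- its cycle (same cycles; runs unchanged or increased by two).
--
-- The heart of the argument is a localisation of crun: crun σ is a sum over
-- the letters x of a local contribution (1 for a cycle minimum, otherwise 1
-- exactly when x is a peak or valley of its cycle word y₁⋯y_k∞).  Inserting
-- n+1 only changes the contributions near y, and a double-counting argument
-- (peaks and valleys are equinumerous) shows that exactly crun σ of the n
-- insertion points keep crun unchanged.
module Submission where

open import Defs
open import Data.Bool using (Bool; true; false; if_then_else_; _xor_; _∧_; _∨_; not; T)
open import Data.Bool.Properties using (∧-zeroʳ)
open import Data.Empty using (⊥; ⊥-elim)
open import Data.Fin as F using (Fin; toℕ; inject₁; fromℕ)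
import Data.Fin.Properties as FP
open import Data.List as L using (List; []; _∷_; _++_; map; concatMap; filter; allFin; length; foldr)
import Data.List.Relation.Unary.All as All
import Data.List.Relation.Unary.AllPairs as AP
import Data.List.Relation.Unary.Unique.DecPropositional as UniqueDec
open import Data.Maybe as Maybe using (Maybe; just; nothing)
open import Data.Nat using (ℕ; zero; suc; _+_; _*_; _∸_; _≤_; _<_; _≥_; z≤n; s≤s; z<s; _<ᵇ_; _≤ᵇ_; _≡ᵇ_)
import Data.Nat.Properties as NP
open import Algebra.Properties.CommutativeSemigroup NP.+-commutativeSemigroup using (interchange)
open import Data.Nat.ListAction using (sum)
open import Data.Product using (Σ; _×_; _,_; proj₁; proj₂)
open import Data.Sum using (_⊎_; inj₁; inj₂)
open import Data.Unit using (tt)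
open import Data.Vec as V using (Vec; tabulate; lookup; toList)
import Data.Vec.Properties as VP
open import Relation.Binary using (tri<; tri≈; tri>)
open import Relation.Binary.PropositionalEquality hiding ([_])
open import Relation.Nullary using (¬_; Dec; yes; no; does)
open ≡-Reasoning

χ : Bool → ℕ
χ true = 1
χ false = 0

f≢t : false ≡ true → ⊥
f≢t ()

χ+χ-not : ∀ b → χ b + χ (not b) ≡ 1
χ+χ-not true = refl
χ+χ-not false = refl

T→≡ : ∀ {b} → T b → b ≡ true
T→≡ {true} _ = refl

≡→T : ∀ {b} → b ≡ true → T b
≡→T refl = tt

∧-true₁ : ∀ {a b} → (a ∧ b) ≡ true → a ≡ true
∧-true₁ {true} _ = refl

∧-true₂ : ∀ {a b} → (a ∧ b) ≡ true → b ≡ true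
∧-true₂ {true} e = e

==-refl : ∀ {n} (i : Fin n) → (i == i) ≡ true
==-refl i = T→≡ (NP.≡⇒≡ᵇ (toℕ i) (toℕ i) refl)

==-true : ∀ {n} {i j : Fin n} → (i == j) ≡ true → i ≡ j
==-true {i = i} {j} e = FP.toℕ-injective (NP.≡ᵇ⇒≡ (toℕ i) (toℕ j) (≡→T e))

==-false : ∀ {n} {i j : Fin n} → ¬ i ≡ j → (i == j) ≡ false
==-false {i = i} {j} ne with i == j in e
... | true = ⊥-elim (ne (==-true e))
... | false = refl

==-false⇒≢ : ∀ {n} {i j : Fin n} → (i == j) ≡ false → ¬ i ≡ j
==-false⇒≢ {i = i} e refl = f≢t (trans (sym e) (==-refl i))

≡ᵇ-true⇒ : ∀ {a b} → (a ≡ᵇ b) ≡ true → a ≡ b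
≡ᵇ-true⇒ {a} {b} e = NP.≡ᵇ⇒≡ a b (≡→T e)

≡ᵇ-false : ∀ {a b} → ¬ a ≡ b → (a ≡ᵇ b) ≡ false
≡ᵇ-false {a} {b} ne with a ≡ᵇ b in e
... | false = refl
... | true = ⊥-elim (ne (≡ᵇ-true⇒ e))

≤ᵇ-true : ∀ {a b} → a ≤ b → (a ≤ᵇ b) ≡ true
≤ᵇ-true p = T→≡ (NP.≤⇒≤ᵇ p)

≤ᵇ-true⇒ : ∀ {a b} → (a ≤ᵇ b) ≡ true → a ≤ b
≤ᵇ-true⇒ {a} {b} e = NP.≤ᵇ⇒≤ a b (≡→T e)

<ᵇ-true : ∀ {a b} → a < b → (a <ᵇ b) ≡ true
<ᵇ-true p = T→≡ (NP.<⇒<ᵇ p)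

<ᵇ-false : ∀ {a b} → b < a → (a <ᵇ b) ≡ false
<ᵇ-false {a} {b} p with a <ᵇ b in e
... | false = refl
... | true = ⊥-elim (NP.<-asym p (NP.<ᵇ⇒< a b (≡→T e)))

∑ : (n : ℕ) → (Fin n → ℕ) → ℕ
∑ zero f = 0
∑ (suc n) f = f F.zero + ∑ n (λ i → f (F.suc i))

∑-cong : ∀ n {f g : Fin n → ℕ} → (∀ i → f i ≡ g i) → ∑ n f ≡ ∑ n g
∑-cong zero h = refl
∑-cong (suc n) h = cong₂ _+_ (h F.zero) (∑-cong n (λ i → h (F.suc i)))

∑-+ : ∀ n (f g : Fin n → ℕ) → ∑ n (λ i → f i + g i) ≡ ∑ n f + ∑ n g
∑-+ zero f g = refl
∑-+ (suc n) f g = trans (cong (f F.zero + g F.zero +_) (∑-+ n _ _)) (interchange (f F.zero) (g F.zero) _ _)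

∑-*ˡ : ∀ n c (f : Fin n → ℕ) → ∑ n (λ i → c * f i) ≡ c * ∑ n f
∑-*ˡ zero c f = sym (NP.*-zeroʳ c)
∑-*ˡ (suc n) c f = trans (cong (c * f F.zero +_) (∑-*ˡ n c _)) (sym (NP.*-distribˡ-+ c (f F.zero) _))

∑-*ʳ : ∀ n (f : Fin n → ℕ) c → ∑ n (λ i → f i * c) ≡ ∑ n f * c
∑-*ʳ n f c = trans (∑-cong n (λ i → NP.*-comm (f i) c)) (trans (∑-*ˡ n c f) (NP.*-comm c (∑ n f)))

∑-0 : ∀ n → ∑ n (λ _ → 0) ≡ 0
∑-0 zero = refl
∑-0 (suc n) = ∑-0 n

∑-1 : ∀ n → ∑ n (λ _ → 1) ≡ n
∑-1 zero = refl
∑-1 (suc n) = cong suc (∑-1 n)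

∑-mono : ∀ n (f g : Fin n → ℕ) → (∀ i → f i ≤ g i) → ∑ n f ≤ ∑ n g
∑-mono zero f g h = z≤n
∑-mono (suc n) f g h = NP.+-mono-≤ (h F.zero) (∑-mono n _ _ (λ i → h (F.suc i)))

∑-swap : ∀ n m (f : Fin n → Fin m → ℕ) → ∑ n (λ i → ∑ m (f i)) ≡ ∑ m (λ j → ∑ n (λ i → f i j))
∑-swap zero m f = sym (∑-0 m)
∑-swap (suc n) m f = trans (cong (∑ m (f F.zero) +_) (∑-swap n m _)) (sym (∑-+ m _ _))

∑-last : ∀ n (f : Fin (suc n) → ℕ) → ∑ (suc n) f ≡ ∑ n (λ i → f (inject₁ i)) + f (fromℕ n)
∑-last zero f = NP.+-comm (f F.zero) 0
∑-last (suc n) f = trans (cong (f F.zero +_) (∑-last n (λ i → f (F.suc i))))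
                         (sym (NP.+-assoc (f F.zero) _ _))

∑-δ : ∀ n (a : Fin n) (f : Fin n → ℕ) → ∑ n (λ i → χ (i == a) * f i) ≡ f a
∑-δ (suc n) F.zero f = begin
  1 * f F.zero + ∑ n (λ i → 0) ≡⟨ cong (1 * f F.zero +_) (∑-0 n) ⟩
  1 * f F.zero + 0             ≡⟨ trans (NP.+-identityʳ _) (NP.*-identityˡ _) ⟩
  f F.zero                     ∎
∑-δ (suc n) (F.suc a) f = ∑-δ n a (λ i → f (F.suc i))

∑-exchange₁ : ∀ n (h g : Fin n → ℕ) a → (∀ x → ¬ x ≡ a → h x ≡ g x) → ∑ n h + g a ≡ ∑ n g + h a
∑-exchange₁ n h g a hyp = begin
  ∑ n h + g a                            ≡⟨ cong (∑ n h +_) (sym (∑-δ n a g)) ⟩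
  ∑ n h + ∑ n (λ x → χ (x == a) * g x)   ≡⟨ sym (∑-+ n _ _) ⟩
  ∑ n (λ x → h x + χ (x == a) * g x)     ≡⟨ ∑-cong n pointwise ⟩
  ∑ n (λ x → g x + χ (x == a) * h x)     ≡⟨ ∑-+ n _ _ ⟩
  ∑ n g + ∑ n (λ x → χ (x == a) * h x)   ≡⟨ cong (∑ n g +_) (∑-δ n a h) ⟩
  ∑ n g + h a                            ∎
  where
  pointwise : ∀ x → h x + χ (x == a) * g x ≡ g x + χ (x == a) * h x
  pointwise x with x == a in e
  ... | true rewrite ==-true {i = x} {j = a} e =
    trans (cong (h a +_) (NP.+-identityʳ _)) (trans (NP.+-comm (h a) (g a)) (cong (g a +_) (sym (NP.+-identityʳ _))))
  ... | false = trans (NP.+-identityʳ _) (trans (hyp x (==-false⇒≢ e)) (sym (NP.+-identityʳ _)))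

∑-exchange₂ : ∀ n (h g : Fin n → ℕ) a b → ¬ a ≡ b → (∀ x → ¬ x ≡ a → ¬ x ≡ b → h x ≡ g x) →
  ∑ n h + (g a + g b) ≡ ∑ n g + (h a + h b)
∑-exchange₂ n h g a b a≢b hyp = begin
  ∑ n h + (g a + g b) ≡⟨ cong (∑ n h +_) (NP.+-comm (g a) (g b)) ⟩
  ∑ n h + (g b + g a) ≡⟨ sym (NP.+-assoc (∑ n h) (g b) (g a)) ⟩
  ∑ n h + g b + g a   ≡⟨ cong (λ z → ∑ n h + z + g a) (sym kb) ⟩
  ∑ n h + k b + g a   ≡⟨ cong (_+ g a) (∑-exchange₁ n h k b hk) ⟩
  ∑ n k + h b + g a   ≡⟨ NP.+-assoc (∑ n k) (h b) (g a) ⟩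
  ∑ n k + (h b + g a) ≡⟨ cong (∑ n k +_) (NP.+-comm (h b) (g a)) ⟩
  ∑ n k + (g a + h b) ≡⟨ sym (NP.+-assoc (∑ n k) (g a) (h b)) ⟩
  ∑ n k + g a + h b   ≡⟨ cong (_+ h b) (∑-exchange₁ n k g a kg) ⟩
  ∑ n g + k a + h b   ≡⟨ cong (λ z → ∑ n g + z + h b) ka ⟩
  ∑ n g + h a + h b   ≡⟨ NP.+-assoc (∑ n g) (h a) (h b) ⟩
  ∑ n g + (h a + h b) ∎
  where
  k : Fin n → ℕ
  k x = if x == b then g b else h x
  kb : k b ≡ g b
  kb rewrite ==-refl b = refl
  hk : ∀ x → ¬ x ≡ b → h x ≡ k x
  hk x ne rewrite ==-false {i = x} {j = b} ne = refl
  kg : ∀ x → ¬ x ≡ a → k x ≡ g x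
  kg x ne with x == b in e
  ... | true = cong g (sym (==-true {i = x} {j = b} e))
  ... | false = hyp x ne (==-false⇒≢ e)
  ka : k a ≡ h a
  ka rewrite ==-false {i = a} {j = b} a≢b = refl

∑ₗ : ∀ {A : Set} → List A → (A → ℕ) → ℕ
∑ₗ [] f = 0
∑ₗ (x ∷ xs) f = f x + ∑ₗ xs f

∑ₗ-cong : ∀ {A : Set} (xs : List A) {g h : A → ℕ} → (∀ x → g x ≡ h x) → ∑ₗ xs g ≡ ∑ₗ xs h
∑ₗ-cong [] _ = refl
∑ₗ-cong (x ∷ xs) e = cong₂ _+_ (e x) (∑ₗ-cong xs e)

∑ₗ-0 : ∀ {A : Set} (xs : List A) → ∑ₗ xs (λ _ → 0) ≡ 0
∑ₗ-0 [] = refl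
∑ₗ-0 (x ∷ xs) = ∑ₗ-0 xs

∑ₗ-+ : ∀ {A : Set} (xs : List A) (g h : A → ℕ) → ∑ₗ xs (λ x → g x + h x) ≡ ∑ₗ xs g + ∑ₗ xs h
∑ₗ-+ [] g h = refl
∑ₗ-+ (x ∷ xs) g h = trans (cong (g x + h x +_) (∑ₗ-+ xs g h)) (interchange (g x) (h x) _ _)

∑ₗ-*ˡ : ∀ {A : Set} (xs : List A) c (h : A → ℕ) → ∑ₗ xs (λ x → c * h x) ≡ c * ∑ₗ xs h
∑ₗ-*ˡ [] c h = sym (NP.*-zeroʳ c)
∑ₗ-*ˡ (x ∷ xs) c h = trans (cong (c * h x +_) (∑ₗ-*ˡ xs c h)) (sym (NP.*-distribˡ-+ c (h x) _))

∑ₗ-*ʳ : ∀ {A : Set} (xs : List A) (h : A → ℕ) c → ∑ₗ xs (λ x → h x * c) ≡ ∑ₗ xs h * c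
∑ₗ-*ʳ xs h c = trans (∑ₗ-cong xs (λ x → NP.*-comm (h x) c)) (trans (∑ₗ-*ˡ xs c h) (NP.*-comm c _))

∑ₗ-++ : ∀ {A : Set} (xs ys : List A) (h : A → ℕ) → ∑ₗ (xs ++ ys) h ≡ ∑ₗ xs h + ∑ₗ ys h
∑ₗ-++ [] ys h = refl
∑ₗ-++ (x ∷ xs) ys h = trans (cong (h x +_) (∑ₗ-++ xs ys h)) (sym (NP.+-assoc (h x) _ _))

∑ₗ-map : ∀ {A B : Set} (g : A → B) (xs : List A) (h : B → ℕ) → ∑ₗ (map g xs) h ≡ ∑ₗ xs (λ x → h (g x))
∑ₗ-map g [] h = refl
∑ₗ-map g (x ∷ xs) h = cong (h (g x) +_) (∑ₗ-map g xs h)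

∑ₗ-concatMap : ∀ {A B : Set} (F : A → List B) (xs : List A) (h : B → ℕ) →
  ∑ₗ (concatMap F xs) h ≡ ∑ₗ xs (λ x → ∑ₗ (F x) h)
∑ₗ-concatMap F [] h = refl
∑ₗ-concatMap F (x ∷ xs) h = trans (∑ₗ-++ (F x) (concatMap F xs) h) (cong (∑ₗ (F x) h +_) (∑ₗ-concatMap F xs h))

∑ₗ-∑-swap : ∀ {A : Set} (xs : List A) m (F : A → Fin m → ℕ) →
  ∑ₗ xs (λ a → ∑ m (F a)) ≡ ∑ m (λ b → ∑ₗ xs (λ a → F a b))
∑ₗ-∑-swap [] m F = sym (∑-0 m)
∑ₗ-∑-swap (x ∷ xs) m F = trans (cong (∑ m (F x) +_) (∑ₗ-∑-swap xs m F)) (sym (∑-+ m _ _))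

∑ₗ-swap : ∀ {A B : Set} (xs : List A) (ys : List B) (F : A → B → ℕ) →
  ∑ₗ xs (λ a → ∑ₗ ys (F a)) ≡ ∑ₗ ys (λ b → ∑ₗ xs (λ a → F a b))
∑ₗ-swap [] ys F = sym (∑ₗ-0 ys)
∑ₗ-swap (x ∷ xs) ys F = trans (cong (∑ₗ ys (F x) +_) (∑ₗ-swap xs ys F)) (sym (∑ₗ-+ ys _ _))

∑ₗ-allFin : ∀ n (f : Fin n → ℕ) → ∑ₗ (allFin n) f ≡ ∑ n f
∑ₗ-allFin n f = go n (λ i → i)
  where
  go : ∀ m (g : Fin m → Fin n) → ∑ₗ (L.tabulate g) f ≡ ∑ m (λ i → f (g i))
  go zero g = refl
  go (suc m) g = cong (f (g F.zero) +_) (go m (λ i → g (F.suc i)))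

∑ₗ-filter : ∀ {A : Set} (b : A → Bool) (xs : List A) (g : A → ℕ) →
  ∑ₗ (filter (λ i → Data.Bool._≟_ (b i) true) xs) g ≡ ∑ₗ xs (λ i → χ (b i) * g i)
∑ₗ-filter b [] g = refl
∑ₗ-filter b (x ∷ xs) g with b x
... | true = cong₂ _+_ (sym (NP.*-identityˡ (g x))) (∑ₗ-filter b xs g)
... | false = ∑ₗ-filter b xs g

∑ₗ-filter? : ∀ {A : Set} {P : A → Set} (P? : ∀ x → Dec (P x)) (xs : List A) (h : A → ℕ) →
  ∑ₗ (filter P? xs) h ≡ ∑ₗ xs (λ x → χ (does (P? x)) * h x)
∑ₗ-filter? P? [] h = refl
∑ₗ-filter? P? (x ∷ xs) h with does (P? x)
... | true = cong₂ _+_ (sym (NP.+-identityʳ (h x))) (∑ₗ-filter? P? xs h)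
... | false = ∑ₗ-filter? P? xs h

sum-map : ∀ {A : Set} (g : A → ℕ) (xs : List A) → sum (map g xs) ≡ ∑ₗ xs g
sum-map g [] = refl
sum-map g (x ∷ xs) = cong (g x +_) (sum-map g xs)

length-∑ₗ : ∀ {A : Set} (xs : List A) → length xs ≡ ∑ₗ xs (λ _ → 1)
length-∑ₗ [] = refl
length-∑ₗ (x ∷ xs) = cong suc (length-∑ₗ xs)

count : ∀ {n} → Fin n → List (Fin n) → ℕ
count x xs = ∑ₗ xs (λ y → χ (x == y))

∑ₗ-count : ∀ n (xs : List (Fin n)) (g : Fin n → ℕ) → ∑ₗ xs g ≡ ∑ n (λ x → count x xs * g x)
∑ₗ-count n [] g = sym (∑-0 n)
∑ₗ-count n (y ∷ xs) g = begin
  g y + ∑ₗ xs g                                                ≡⟨ cong₂ _+_ (sym (∑-δ n y g)) (∑ₗ-count n xs g) ⟩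
  ∑ n (λ x → χ (x == y) * g x) + ∑ n (λ x → count x xs * g x)  ≡⟨ sym (∑-+ n _ _) ⟩
  ∑ n (λ x → χ (x == y) * g x + count x xs * g x)              ≡⟨ ∑-cong n (λ x → sym (NP.*-distribʳ-+ (g x) (χ (x == y)) (count x xs))) ⟩
  ∑ n (λ x → (χ (x == y) + count x xs) * g x)                  ∎

module LeastWitness (P : ℕ → Set) (dec : ∀ u → Dec (P u)) where
  Min : ℕ → Set
  Min m = P m × (∀ u → u < m → ¬ P u)

  search : ∀ d → (Σ ℕ λ m → m ≤ d × Min m) ⊎ (∀ u → u ≤ d → ¬ P u)
  search zero with dec 0
  ... | yes p = inj₁ (0 , z≤n , p , λ u ())
  ... | no np = inj₂ λ { zero _ → np }
  search (suc d) with search d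
  ... | inj₁ (m , m≤d , mn) = inj₁ (m , NP.m≤n⇒m≤1+n m≤d , mn)
  ... | inj₂ none with dec (suc d)
  ...   | yes p = inj₁ (suc d , NP.≤-refl , p , λ u u<sd → none u (NP.≤-pred u<sd))
  ...   | no np = inj₂ below
    where
    below : ∀ u → u ≤ suc d → ¬ P u
    below u u≤sd with NP.m≤n⇒m<n∨m≡n u≤sd
    ... | inj₁ u<sd = none u (NP.≤-pred u<sd)
    ... | inj₂ refl = np

  least : ∀ d → P d → Σ ℕ λ m → m ≤ d × Min m
  least d p with search d
  ... | inj₁ r = r
  ... | inj₂ none = ⊥-elim (none d NP.≤-refl p)

-- The cycle structure of a permutation

Inj : ∀ {n} → Perm n → Set
Inj {n} v = ∀ (a b : Fin n) → app v a ≡ app v b → a ≡ b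

module Cycles {n : ℕ} (v : Perm n) (inj : Inj v) where

  f : Fin n → Fin n
  f = app v

  iter : ℕ → Fin n → Fin n
  iter zero x = x
  iter (suc t) x = f (iter t x)

  iter-shift : ∀ t x → iter t (f x) ≡ iter (suc t) x
  iter-shift zero x = refl
  iter-shift (suc t) x = cong f (iter-shift t x)

  iter-+ : ∀ a b x → iter (a + b) x ≡ iter a (iter b x)
  iter-+ zero b x = refl
  iter-+ (suc a) b x = cong f (iter-+ a b x)

  iter-injective : ∀ t {a b} → iter t a ≡ iter t b → a ≡ b
  iter-injective zero e = e
  iter-injective (suc t) e = iter-injective t (inj _ _ e)

  gap-split : ∀ {a b} → a < b → suc (b ∸ suc a) + a ≡ b
  gap-split {a} {b} a<b = trans (cong (_+ a) (sym (NP.+-∸-assoc 1 a<b))) (NP.m∸n+n≡m (NP.<⇒≤ a<b))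

  iter-gap : ∀ x {a b} → a < b → iter a x ≡ iter b x → iter (suc (b ∸ suc a)) x ≡ x
  iter-gap x {a} {b} a<b eq = sym (iter-injective a (begin
    iter a x            ≡⟨ eq ⟩
    iter b x            ≡⟨ cong (λ k → iter k x) (sym (gap-split a<b)) ⟩
    iter (suc d + a) x  ≡⟨ cong (λ k → iter k x) (NP.+-comm (suc d) a) ⟩
    iter (a + suc d) x  ≡⟨ iter-+ a (suc d) x ⟩
    iter a (iter (suc d) x) ∎))
    where
    d : ℕ
    d = b ∸ suc a

  -- Some power fᵉ⁺¹ with e < n fixes x (pigeonhole on x, f x, …, fⁿ x).
  return∃ : ∀ x → Σ ℕ λ e → e < n × iter (suc e) x ≡ x
  return∃ x with FP.pigeonhole (NP.n<1+n n) (λ t → iter (toℕ t) x)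
  ... | i , j , i<j , eq = toℕ j ∸ suc (toℕ i) , bound , iter-gap x i<j eq
    where
    bound : toℕ j ∸ suc (toℕ i) < n
    bound = NP.≤-trans (NP.≤-trans (NP.m≤m+n _ (toℕ i)) (NP.≤-reflexive (gap-split i<j))) (NP.≤-pred (FP.toℕ<n j))

  -- The least such power: the cycle of x has length cycLen x = lastIndex x + 1.
  abstract
    period : ∀ x → Σ ℕ λ e → e < n × iter (suc e) x ≡ x × (∀ u → u < e → ¬ iter (suc u) x ≡ x)
    period x with return∃ x
    ... | d , d<n , r with LeastWitness.least (λ e → iter (suc e) x ≡ x) (λ e → iter (suc e) x FP.≟ x) d r
    ... | m , m≤d , p , mn = m , NP.≤-<-trans m≤d d<n , p , mn

  lastIndex : Fin n → ℕ
  lastIndex x = proj₁ (period x)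

  cycLen : Fin n → ℕ
  cycLen x = suc (lastIndex x)

  lastIndex<n : ∀ x → lastIndex x < n
  lastIndex<n x = proj₁ (proj₂ (period x))

  iter-cycLen : ∀ x → iter (cycLen x) x ≡ x
  iter-cycLen x = proj₁ (proj₂ (proj₂ (period x)))

  iter-notReturned : ∀ x u → u < lastIndex x → ¬ iter (suc u) x ≡ x
  iter-notReturned x = proj₂ (proj₂ (proj₂ (period x)))

  iter-*cycLen : ∀ x c → iter (c * cycLen x) x ≡ x
  iter-*cycLen x zero = refl
  iter-*cycLen x (suc c) = begin
    iter (cycLen x + c * cycLen x) x         ≡⟨ iter-+ (cycLen x) (c * cycLen x) x ⟩
    iter (cycLen x) (iter (c * cycLen x) x)  ≡⟨ cong (iter (cycLen x)) (iter-*cycLen x c) ⟩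
    iter (cycLen x) x                        ≡⟨ iter-cycLen x ⟩
    x                                        ∎

  reduceIndex : ∀ x u → Σ ℕ λ t → t < cycLen x × iter u x ≡ iter t x
  reduceIndex x zero = 0 , s≤s z≤n , refl
  reduceIndex x (suc u) with reduceIndex x u
  ... | t , t<K , e with NP.m≤n⇒m<n∨m≡n t<K
  ...   | inj₁ st<K = suc t , st<K , cong f e
  ...   | inj₂ st≡K = 0 , s≤s z≤n , trans (cong f e) (trans (cong (λ k → iter k x) st≡K) (iter-cycLen x))

  orbit-noRepeat : ∀ x {a b} → a < b → b < cycLen x → ¬ iter a x ≡ iter b x
  orbit-noRepeat x {a} {b} a<b b<K eq = iter-notReturned x _ d<last (iter-gap x a<b eq)
    where
    d<last : b ∸ suc a < lastIndex x
    d<last = NP.≤-pred (NP.≤-trans (s≤s (NP.≤-trans (NP.m≤m+n _ a) (NP.≤-reflexive (gap-split a<b)))) b<K)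

  orbit-distinct : ∀ x a b → a < cycLen x → b < cycLen x → iter a x ≡ iter b x → a ≡ b
  orbit-distinct x a b a<K b<K eq with NP.<-cmp a b
  ... | tri< a<b _ _ = ⊥-elim (orbit-noRepeat x a<b b<K eq)
  ... | tri≈ _ a≡b _ = a≡b
  ... | tri> _ _ b<a = ⊥-elim (orbit-noRepeat x b<a a<K (sym eq))

  segment : Fin n → ℕ → List (Fin n)
  segment y zero = []
  segment y (suc e) = y ∷ segment (f y) e

  orbitFrom≡segment : ∀ i fuel e y → e ≤ fuel → iter e y ≡ i → (∀ u → u < e → ¬ iter u y ≡ i) →
    orbitFrom v i fuel y ≡ segment y e
  orbitFrom≡segment i zero zero y _ _ _ = refl
  orbitFrom≡segment i (suc fuel) zero y _ refl _ rewrite ==-refl y = refl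
  orbitFrom≡segment i (suc fuel) (suc e) y (s≤s le) r mn
    rewrite ==-false {i = y} {j = i} (mn 0 (s≤s z≤n)) =
    cong (y ∷_) (orbitFrom≡segment i fuel e (f y) le (trans (iter-shift e y) r)
      (λ u u<e eq → mn (suc u) (s≤s u<e) (trans (sym (iter-shift u y)) eq)))

  orbit≡segment : ∀ x → orbit v x ≡ segment x (cycLen x)
  orbit≡segment x = cong (x ∷_) (orbitFrom≡segment x n (lastIndex x) (f x) (NP.<⇒≤ (lastIndex<n x))
    (trans (iter-shift (lastIndex x) x) (iter-cycLen x))
    (λ u u<e eq → iter-notReturned x u u<e (trans (sym (iter-shift u x)) eq)))

  ∑ₗ-segment : ∀ y k (g : Fin n → ℕ) → ∑ₗ (segment y k) g ≡ ∑ k (λ u → g (iter (toℕ u) y))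
  ∑ₗ-segment y zero g = refl
  ∑ₗ-segment y (suc k) g = cong (g y +_) (trans (∑ₗ-segment (f y) k g)
    (∑-cong k (λ u → cong g (iter-shift (toℕ u) y))))

  foldAll : (P : Fin n → Bool) → ∀ y k → foldr (λ z b → P z ∧ b) true (segment y k) ≡ true →
    ∀ u → u < k → P (iter u y) ≡ true
  foldAll P y (suc k) h zero _ = ∧-true₁ h
  foldAll P y (suc k) h (suc u) (s≤s u<k) =
    trans (cong P (sym (iter-shift u y))) (foldAll P (f y) k (∧-true₂ {P y} h) u u<k)

  allFold : (P : Fin n → Bool) → ∀ y k → (∀ u → u < k → P (iter u y) ≡ true) →
    foldr (λ z b → P z ∧ b) true (segment y k) ≡ true
  allFold P y zero h = refl
  allFold P y (suc k) h rewrite h 0 (s≤s z≤n) =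
    allFold P (f y) k (λ u u<k → trans (cong P (iter-shift u y)) (h (suc u) (s≤s u<k)))

  isMin : Fin n → Bool
  isMin = isCycleMin v

  allLe : Fin n → List (Fin n) → Bool
  allLe x xs = foldr (λ y b → (toℕ x ≤ᵇ toℕ y) ∧ b) true xs

  isMin⇒≤ : ∀ x → isMin x ≡ true → ∀ u → toℕ x ≤ toℕ (iter u x)
  isMin⇒≤ x h u with reduceIndex x u
  ... | t , t<K , e = subst (λ z → toℕ x ≤ toℕ z) (sym e)
     (≤ᵇ-true⇒ (foldAll (λ y → toℕ x ≤ᵇ toℕ y) x (cycLen x) (trans (sym (cong (allLe x) (orbit≡segment x))) h) t t<K))

  ≤⇒isMin : ∀ x → (∀ u → toℕ x ≤ toℕ (iter u x)) → isMin x ≡ true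
  ≤⇒isMin x h = trans (cong (allLe x) (orbit≡segment x))
    (allFold (λ y → toℕ x ≤ᵇ toℕ y) x (cycLen x) (λ u _ → ≤ᵇ-true (h u)))

  fixedPoint-isMin : ∀ y → f y ≡ y → isMin y ≡ true
  fixedPoint-isMin y e = ≤⇒isMin y (λ u → NP.≤-reflexive (cong toℕ (sym (iter-fixed u))))
    where
    iter-fixed : ∀ u → iter u y ≡ y
    iter-fixed zero = refl
    iter-fixed (suc u) = trans (cong f (iter-fixed u)) e

  pred : Fin n → Fin n
  pred x = iter (lastIndex x) x

  f-pred : ∀ x → f (pred x) ≡ x
  f-pred x = iter-cycLen x

  pred-uniq : ∀ {a b} → f a ≡ b → pred b ≡ a
  pred-uniq {a} {b} e = inj (pred b) a (trans (f-pred b) (sym e))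

  pred-f : ∀ a → pred (f a) ≡ a
  pred-f a = pred-uniq refl

  isMin-inner : ∀ i → isMin i ≡ true → ∀ t → 0 < t → t < cycLen i → isMin (iter t i) ≡ false
  isMin-inner i mi (suc u) _ st<K with isMin (iter (suc u) i) in e
  ... | false = refl
  ... | true = ⊥-elim (iter-notReturned i u (NP.≤-pred st<K) (FP.toℕ-injective (NP.≤-antisym y≤i i≤y)))
    where
    y : Fin n
    y = iter (suc u) i
    back : iter (cycLen i ∸ suc u) y ≡ i
    back = trans (sym (iter-+ (cycLen i ∸ suc u) (suc u) i))
                 (trans (cong (λ k → iter k i) (NP.m∸n+n≡m (NP.<⇒≤ st<K))) (iter-cycLen i))
    y≤i : toℕ y ≤ toℕ i
    y≤i = subst (λ z → toℕ y ≤ toℕ z) back (isMin⇒≤ y e (cycLen i ∸ suc u))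
    i≤y : toℕ i ≤ toℕ y
    i≤y = isMin⇒≤ i mi (suc u)

  isMin-ascends : ∀ x → isMin x ≡ true → isMin (f x) ≡ false → toℕ x < toℕ (f x)
  isMin-ascends x mx mfx = NP.≤∧≢⇒< (isMin⇒≤ x mx 1)
    (λ e → f≢t (trans (sym mfx) (trans (cong isMin (sym (FP.toℕ-injective e))) mx)))

  SameCycle : Fin n → Fin n → Set
  SameCycle x y = Σ ℕ λ t → y ≡ iter t x

  sameCycle-trans : ∀ {x y z} → SameCycle x y → SameCycle y z → SameCycle x z
  sameCycle-trans (t , refl) (s , refl) = s + t , sym (iter-+ s t _)

  sameCycle-sym : ∀ {x y} → SameCycle x y → SameCycle y x
  sameCycle-sym {x} (t , refl) = t * lastIndex x , sym (begin
    iter (t * lastIndex x) (iter t x) ≡⟨ sym (iter-+ (t * lastIndex x) t x) ⟩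
    iter (t * lastIndex x + t) x      ≡⟨ cong (λ k → iter k x) (trans (NP.+-comm (t * lastIndex x) t) (sym (NP.*-suc t (lastIndex x)))) ⟩
    iter (t * cycLen x) x             ≡⟨ iter-*cycLen x t ⟩
    x                                 ∎)

  minFrom : Fin n → ℕ → Fin n
  minFrom y zero = y
  minFrom y (suc k) = if toℕ y ≤ᵇ toℕ (minFrom (f y) k) then y else minFrom (f y) k

  minFrom-sameCycle : ∀ y k → SameCycle y (minFrom y k)
  minFrom-sameCycle y zero = 0 , refl
  minFrom-sameCycle y (suc k) with toℕ y ≤ᵇ toℕ (minFrom (f y) k)
  ... | true = 0 , refl
  ... | false = sameCycle-trans (1 , refl) (minFrom-sameCycle (f y) k)

  minFrom-≤ : ∀ y k t → t ≤ k → toℕ (minFrom y k) ≤ toℕ (iter t y)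
  minFrom-≤ y zero zero _ = NP.≤-refl
  minFrom-≤ y (suc k) t t≤k with toℕ y ≤ᵇ toℕ (minFrom (f y) k) in e
  minFrom-≤ y (suc k) zero t≤k | true = NP.≤-refl
  minFrom-≤ y (suc k) (suc t) (s≤s t≤k) | true =
    NP.≤-trans (≤ᵇ-true⇒ e) (subst (λ z → toℕ (minFrom (f y) k) ≤ toℕ z) (iter-shift t y) (minFrom-≤ (f y) k t t≤k))
  minFrom-≤ y (suc k) zero t≤k | false with NP.≤-total (toℕ y) (toℕ (minFrom (f y) k))
  ... | inj₁ le = ⊥-elim (subst T e (NP.≤⇒≤ᵇ le))
  ... | inj₂ le = le
  minFrom-≤ y (suc k) (suc t) (s≤s t≤k) | false =
    subst (λ z → toℕ (minFrom (f y) k) ≤ toℕ z) (iter-shift t y) (minFrom-≤ (f y) k t t≤k)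

  cycleMin : Fin n → Fin n
  cycleMin x = minFrom x (lastIndex x)

  cycleMin-sameCycle : ∀ x → SameCycle x (cycleMin x)
  cycleMin-sameCycle x = minFrom-sameCycle x (lastIndex x)

  cycleMin-≤ : ∀ x u → toℕ (cycleMin x) ≤ toℕ (iter u x)
  cycleMin-≤ x u with reduceIndex x u
  ... | t , t<K , e = subst (λ z → toℕ (cycleMin x) ≤ toℕ z) (sym e) (minFrom-≤ x (lastIndex x) t (NP.≤-pred t<K))

  cycleMin-isMin : ∀ x → isMin (cycleMin x) ≡ true
  cycleMin-isMin x = ≤⇒isMin (cycleMin x) below
    where
    below : ∀ u → toℕ (cycleMin x) ≤ toℕ (iter u (cycleMin x))
    below u with cycleMin-sameCycle x
    ... | s , e = subst (λ z → toℕ (cycleMin x) ≤ toℕ z)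
        (trans (iter-+ u s x) (cong (iter u) (sym e))) (cycleMin-≤ x (u + s))

  isMin-unique : ∀ {i j} → isMin i ≡ true → isMin j ≡ true → SameCycle i j → i ≡ j
  isMin-unique {i} {j} mi mj (t , e) with sameCycle-sym (t , e)
  ... | s , e' = FP.toℕ-injective (NP.≤-antisym
      (subst (λ z → toℕ i ≤ toℕ z) (sym e) (isMin⇒≤ i mi t))
      (subst (λ z → toℕ j ≤ toℕ z) (sym e') (isMin⇒≤ j mj s)))

  count-ownCycle : ∀ i x → SameCycle i x → count x (segment i (cycLen i)) ≡ 1
  count-ownCycle i x (t0 , e0) with reduceIndex i t0
  ... | t , t<K , e1 = begin
    count x (segment i (cycLen i))                 ≡⟨ ∑ₗ-segment i (cycLen i) (λ y → χ (x == y)) ⟩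
    ∑ (cycLen i) (λ u → χ (x == iter (toℕ u) i))   ≡⟨ ∑-cong (cycLen i) pointwise ⟩
    ∑ (cycLen i) (λ u → χ (u == t') * 1)           ≡⟨ ∑-δ (cycLen i) t' (λ _ → 1) ⟩
    1                                              ∎
    where
    t' : Fin (cycLen i)
    t' = F.fromℕ< t<K
    x≡ : x ≡ iter t i
    x≡ = trans e0 e1
    pointwise : ∀ u → χ (x == iter (toℕ u) i) ≡ χ (u == t') * 1
    pointwise u with u == t' in eu
    ... | true = cong χ (trans (cong (x ==_) hit) (==-refl x))
      where
      hit : iter (toℕ u) i ≡ x
      hit = trans (cong (λ k → iter (toℕ k) i) (==-true {i = u} {j = t'} eu))
                  (trans (cong (λ k → iter k i) (FP.toℕ-fromℕ< t<K)) (sym x≡))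
    ... | false with x == iter (toℕ u) i in ex
    ...   | false = refl
    ...   | true = ⊥-elim (==-false⇒≢ eu (FP.toℕ-injective
              (trans (orbit-distinct i (toℕ u) t (FP.toℕ<n u) t<K (trans (sym (==-true ex)) x≡))
                     (sym (FP.toℕ-fromℕ< t<K)))))

  count-otherCycle : ∀ i x k → ¬ SameCycle i x → count x (segment i k) ≡ 0
  count-otherCycle i x k ncy = trans (∑ₗ-segment i k (λ y → χ (x == y))) (trans (∑-cong k pointwise) (∑-0 k))
    where
    pointwise : ∀ u → χ (x == iter (toℕ u) i) ≡ 0
    pointwise u with x == iter (toℕ u) i in ex
    ... | false = refl
    ... | true = ⊥-elim (ncy (toℕ u , ==-true ex))

  cycleMin-partition : ∀ x → ∑ n (λ i → χ (isMin i) * count x (orbit v i)) ≡ 1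
  cycleMin-partition x = trans (∑-cong n pointwise) (∑-δ n (cycleMin x) (λ _ → 1))
    where
    pointwise : ∀ i → χ (isMin i) * count x (orbit v i) ≡ χ (i == cycleMin x) * 1
    pointwise i with isMin i in mi
    ... | false with i == cycleMin x in e
    ...   | false = refl
    ...   | true = ⊥-elim (f≢t (trans (sym mi) (trans (cong isMin (==-true e)) (cycleMin-isMin x))))
    pointwise i | true with i == cycleMin x in e
    ... | true = trans (NP.+-identityʳ _) (trans (cong (count x) (orbit≡segment i))
          (subst (λ j → count x (segment j (cycLen j)) ≡ 1) (sym (==-true e))
                 (count-ownCycle (cycleMin x) x (sameCycle-sym (cycleMin-sameCycle x)))))
    ... | false = trans (NP.+-identityʳ _) (trans (cong (count x) (orbit≡segment i)) (count-otherCycle i x (cycLen i) ncy))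
      where
      ncy : ¬ SameCycle i x
      ncy c = ==-false⇒≢ e (isMin-unique mi (cycleMin-isMin x) (sameCycle-trans c (cycleMin-sameCycle x)))

  ∑-reindex : ∀ (g : Fin n → ℕ) → ∑ n (λ x → g (f x)) ≡ ∑ n g
  ∑-reindex g = begin
    ∑ n (λ x → g (f x))                                ≡⟨ ∑-cong n (λ x → sym (∑-δ n (f x) g)) ⟩
    ∑ n (λ x → ∑ n (λ y → χ (y == f x) * g y))         ≡⟨ ∑-swap n n _ ⟩
    ∑ n (λ y → ∑ n (λ x → χ (y == f x) * g y))         ≡⟨ ∑-cong n (λ y → ∑-*ʳ n (λ x → χ (y == f x)) (g y)) ⟩
    ∑ n (λ y → ∑ n (λ x → χ (y == f x)) * g y)         ≡⟨ ∑-cong n (λ y → trans (cong (_* g y) (onePreimage y)) (NP.*-identityˡ _)) ⟩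
    ∑ n g                                              ∎
    where
    onePreimage : ∀ y → ∑ n (λ x → χ (y == f x)) ≡ 1
    onePreimage y = trans (∑-cong n pointwise) (∑-δ n (pred y) (λ _ → 1))
      where
      pointwise : ∀ x → χ (y == f x) ≡ χ (x == pred y) * 1
      pointwise x with x == pred y in e
      ... | true = cong χ (trans (cong (y ==_) (trans (cong f (==-true {i = x} {j = pred y} e)) (f-pred y))) (==-refl y))
      ... | false with y == f x in e2
      ...   | false = refl
      ...   | true = ⊥-elim (==-false⇒≢ e (sym (pred-uniq (sym (==-true {i = y} {j = f x} e2)))))

-- The local form of crun and cyc

turn : ℕ → ℕ → ℕ → ℕ
turn a b c = if (a <ᵇ b) xor (b <ᵇ c) then 1 else 0

-- Truth-table identities behind the double counting below.  In them m stands
-- for "y is a cycle minimum", a for "pred y < y" and q for "y < next y".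
χ-localRuns : ∀ m a q → (if m then 1 else (if a xor q then 1 else 0)) ≡
  χ m + (χ (not m ∧ (a ∧ not q)) + χ (not m ∧ (not a ∧ q)))
χ-localRuns true a q = refl
χ-localRuns false true true = refl
χ-localRuns false true false = refl
χ-localRuns false false true = refl
χ-localRuns false false false = refl

χ-keeps : ∀ mY mZ a b c q0 → (mZ ≡ true → q0 ≡ true) → (mZ ≡ false → q0 ≡ b) →
  χ (if mZ then true else ((not mY ∧ (a ∧ not b)) ∨ (b ∧ not c))) ≡
  χ mZ + (χ (not mY ∧ (a ∧ not q0)) + χ (not mZ ∧ (b ∧ not c)))
χ-keeps mY true a b c q0 h1 h2 rewrite h1 refl with mY | a
... | true | _ = refl
... | false | true = refl
... | false | false = refl
χ-keeps mY false a b c q0 h1 h2 rewrite h2 refl with mY | a | b | c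
... | true | _ | true | true = refl
... | true | _ | true | false = refl
... | true | _ | false | _ = refl
... | false | false | true | true = refl
... | false | false | true | false = refl
... | false | false | false | _ = refl
... | false | true | true | true = refl
... | false | true | true | false = refl
... | false | true | false | _ = refl

χ-peak-valley : ∀ m a q → χ (not m ∧ (a ∧ not q)) + χ (not m ∧ q) ≡ χ (not m ∧ a) + χ (not m ∧ (not a ∧ q))
χ-peak-valley true a q = refl
χ-peak-valley false true true = refl
χ-peak-valley false true false = refl
χ-peak-valley false false true = refl
χ-peak-valley false false false = refl

χ-ascent-shift : ∀ a b c q → (b ≡ true → q ≡ true) → (b ≡ false → q ≡ c) → (a ≡ true → b ≡ false → c ≡ true) →
  χ (not b ∧ c) + χ (not a ∧ b) ≡ χ (not a ∧ q) + χ (a ∧ not b)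
χ-ascent-shift a true c q h1 h2 h3 rewrite h1 refl with a
... | true = refl
... | false = refl
χ-ascent-shift a false c q h1 h2 h3 rewrite h2 refl with a
... | true rewrite h3 refl refl = refl
... | false = refl

χ-splitˡ : ∀ a b → χ b ≡ χ (a ∧ b) + χ (not a ∧ b)
χ-splitˡ true b = sym (NP.+-identityʳ _)
χ-splitˡ false b = refl

χ-splitʳ : ∀ a b → χ a ≡ χ (a ∧ b) + χ (a ∧ not b)
χ-splitʳ true true = refl
χ-splitʳ true false = refl
χ-splitʳ false b = refl

module RunStatistics {n : ℕ} (v : Perm n) (inj : Inj v) where

  open Cycles v inj public

  succOr∞ : Fin n → ℕ
  succOr∞ y = if isMin (f y) then n else toℕ (f y)

  localRuns : Fin n → ℕ
  localRuns y = if isMin y then 1 else turn (toℕ (pred y)) (toℕ y) (succOr∞ y)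

  localRuns-eqn : ∀ y {m a b c} → isMin y ≡ m → toℕ (pred y) ≡ a → toℕ y ≡ b → succOr∞ y ≡ c →
    localRuns y ≡ (if m then 1 else turn a b c)
  localRuns-eqn y refl refl refl refl = refl

  succOr∞-eqn : ∀ y {m c} → isMin (f y) ≡ m → toℕ (f y) ≡ c → succOr∞ y ≡ (if m then n else c)
  succOr∞-eqn y refl refl = refl

  localRuns-min : ∀ y → isMin y ≡ true → localRuns y ≡ 1
  localRuns-min y e rewrite e = refl

  -- The local contribution of the letter f y, when f y is not the last letter
  -- of its cycle word (e' letters follow it) resp. is the last one (e' = 0).
  afterNext : Fin n → ℕ → ℕ
  afterNext y zero = n
  afterNext y (suc _) = toℕ (f (f y))

  localRuns-next : ∀ i → isMin i ≡ true → ∀ t e' y → y ≡ iter t i → t + suc e' ≡ lastIndex i →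
    localRuns (f y) ≡ turn (toℕ y) (toℕ (f y)) (afterNext y e')
  localRuns-next i mi t e' y refl te = begin
    localRuns (f y)                                        ≡⟨ localRuns-eqn (f y) (isMin-inner i mi (suc t) z<s (s≤s st≤last)) refl refl refl ⟩
    turn (toℕ (pred (f y))) (toℕ (f y)) (succOr∞ (f y))    ≡⟨ cong₂ (λ a c → turn (toℕ a) (toℕ (f y)) c) (pred-f y) (next e' te) ⟩
    turn (toℕ y) (toℕ (f y)) (afterNext y e')              ∎
    where
    st≤last : suc t ≤ lastIndex i
    st≤last = subst (suc t ≤_) te (NP.m<m+n t z<s)
    next : ∀ e'' → t + suc e'' ≡ lastIndex i → succOr∞ (f y) ≡ afterNext y e''
    next zero te' = succOr∞-eqn (f y)
      (trans (cong (λ k → isMin (iter (suc k) i)) (trans (NP.+-comm 1 t) te'))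
             (trans (cong isMin (iter-cycLen i)) mi)) refl
    next (suc e'') te' = succOr∞-eqn (f y)
      (isMin-inner i mi (suc (suc t)) z<s (s≤s (subst (suc (suc t) ≤_) te'
        (NP.≤-trans (NP.≤-reflexive (NP.+-comm 2 t)) (NP.+-monoʳ-≤ t (s≤s (s≤s z≤n))))))) refl

  cycleWord : Fin n → ℕ → List ℕ
  cycleWord y k = map toℕ (segment y k) ++ (n ∷ [])

  turns-cycleWord : ∀ i → isMin i ≡ true → ∀ e t y → y ≡ iter t i → t + e ≡ lastIndex i →
    turns (cycleWord y (suc e)) ≡ ∑ₗ (segment (f y) e) localRuns
  turns-cycleWord i mi zero t y ye te = refl
  turns-cycleWord i mi (suc zero) t y ye te =
    trans (NP.+-identityʳ _) (trans (sym (localRuns-next i mi t 0 y ye te)) (sym (NP.+-identityʳ _)))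
  turns-cycleWord i mi (suc (suc e)) t y ye te =
    cong₂ _+_ (sym (localRuns-next i mi t (suc e) y ye te))
      (turns-cycleWord i mi (suc e) (suc t) (f y) (cong f ye) (trans (sym (NP.+-suc t (suc e))) te))

  crunCycle≡∑localRuns : ∀ i → isMin i ≡ true → crunCycle v i ≡ ∑ₗ (orbit v i) localRuns
  crunCycle≡∑localRuns i mi = trans (cong (λ o → altRuns (map toℕ o ++ (n ∷ []))) (orbit≡segment i))
    (trans (fromMin (lastIndex i) refl) (cong (λ o → ∑ₗ o localRuns) (sym (orbit≡segment i))))
    where
    fromMin : ∀ e → e ≡ lastIndex i → altRuns (cycleWord i (suc e)) ≡ ∑ₗ (segment i (suc e)) localRuns
    fromMin zero _ = sym (cong (_+ 0) (localRuns-min i mi))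
    fromMin (suc e) ee = trans (cong suc (turns-cycleWord i mi (suc e) 0 i refl ee))
                               (sym (cong (_+ ∑ₗ (segment (f i) (suc e)) localRuns) (localRuns-min i mi)))

  -- crun is the sum of the local contributions, since the canonical cycle
  -- words partition [n].
  crun≡∑localRuns : crun v ≡ ∑ n localRuns
  crun≡∑localRuns = begin
    crun v                                                 ≡⟨ sum-map (crunCycle v) (cycleMins v) ⟩
    ∑ₗ (cycleMins v) (crunCycle v)                         ≡⟨ ∑ₗ-filter isMin (allFin n) (crunCycle v) ⟩
    ∑ₗ (allFin n) (λ i → χ (isMin i) * crunCycle v i)      ≡⟨ ∑ₗ-allFin n _ ⟩
    ∑ n (λ i → χ (isMin i) * crunCycle v i)                ≡⟨ ∑-cong n perCycle ⟩
    ∑ n (λ i → ∑ n (λ x → χ (isMin i) * count x (orbit v i) * localRuns x))  ≡⟨ ∑-swap n n _ ⟩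
    ∑ n (λ x → ∑ n (λ i → χ (isMin i) * count x (orbit v i) * localRuns x))  ≡⟨ ∑-cong n (λ x → ∑-*ʳ n _ (localRuns x)) ⟩
    ∑ n (λ x → ∑ n (λ i → χ (isMin i) * count x (orbit v i)) * localRuns x)  ≡⟨ ∑-cong n (λ x → trans (cong (_* localRuns x) (cycleMin-partition x)) (NP.*-identityˡ (localRuns x))) ⟩
    ∑ n localRuns                                          ∎
    where
    perCycle : ∀ i → χ (isMin i) * crunCycle v i ≡ ∑ n (λ x → χ (isMin i) * count x (orbit v i) * localRuns x)
    perCycle i = begin
      χ (isMin i) * crunCycle v i                                   ≡⟨ asSum (isMin i) refl ⟩
      χ (isMin i) * ∑ n (λ x → count x (orbit v i) * localRuns x)   ≡⟨ sym (∑-*ˡ n (χ (isMin i)) _) ⟩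
      ∑ n (λ x → χ (isMin i) * (count x (orbit v i) * localRuns x)) ≡⟨ ∑-cong n (λ x → sym (NP.*-assoc (χ (isMin i)) _ (localRuns x))) ⟩
      ∑ n (λ x → χ (isMin i) * count x (orbit v i) * localRuns x)   ∎
      where
      asSum : ∀ m → isMin i ≡ m → χ m * crunCycle v i ≡ χ m * ∑ n (λ x → count x (orbit v i) * localRuns x)
      asSum true e = cong (1 *_) (trans (crunCycle≡∑localRuns i e) (∑ₗ-count n (orbit v i) localRuns))
      asSum false _ = refl

  cyc≡∑isMin : cyc v ≡ ∑ n (λ i → χ (isMin i))
  cyc≡∑isMin = begin
    cyc v                                   ≡⟨ length-∑ₗ (cycleMins v) ⟩
    ∑ₗ (cycleMins v) (λ _ → 1)              ≡⟨ ∑ₗ-filter isMin (allFin n) (λ _ → 1) ⟩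
    ∑ₗ (allFin n) (λ i → χ (isMin i) * 1)   ≡⟨ ∑ₗ-allFin n _ ⟩
    ∑ n (λ i → χ (isMin i) * 1)             ≡⟨ ∑-cong n (λ i → NP.*-identityʳ _) ⟩
    ∑ n (λ i → χ (isMin i))                 ∎

  ascent : Fin n → Fin n → Bool
  ascent a b = toℕ a <ᵇ toℕ b

  ascentIn : Fin n → Bool
  ascentIn y = toℕ (pred y) <ᵇ toℕ y

  ascentOut : Fin n → Bool
  ascentOut y = toℕ y <ᵇ succOr∞ y

  peak : Fin n → Bool
  peak y = not (isMin y) ∧ (ascentIn y ∧ not (ascentOut y))

  valley : Fin n → Bool
  valley y = not (isMin y) ∧ (not (ascentIn y) ∧ ascentOut y)

  -- keeps y: inserting a new largest letter between y and f y does not change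
  -- crun.  This happens when y ends its cycle word, when y is a peak, or when
  -- f y is a peak (the new letter then takes over its role).
  keeps : Fin n → Bool
  keeps y = if isMin (f y) then true else
    ((not (isMin y) ∧ (ascentIn y ∧ not (ascent y (f y)))) ∨ (ascent y (f y) ∧ not (ascentOut (f y))))

  ascentOut-min : ∀ y → isMin (f y) ≡ true → ascentOut y ≡ true
  ascentOut-min y e = trans (cong (toℕ y <ᵇ_) (succOr∞-eqn y e refl)) (<ᵇ-true (FP.toℕ<n y))

  ascentOut-nonMin : ∀ y → isMin (f y) ≡ false → ascentOut y ≡ ascent y (f y)
  ascentOut-nonMin y e = cong (toℕ y <ᵇ_) (succOr∞-eqn y e refl)

  ascentIn-next : ∀ y → ascentIn (f y) ≡ ascent y (f y)
  ascentIn-next y = cong (λ z → toℕ z <ᵇ toℕ (f y)) (pred-f y)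

  localRuns-split : ∀ y → localRuns y ≡ χ (isMin y) + (χ (peak y) + χ (valley y))
  localRuns-split y = χ-localRuns (isMin y) (ascentIn y) (ascentOut y)

  keeps-split : ∀ y → χ (keeps y) ≡ χ (isMin (f y)) + (χ (peak y) + χ (peak (f y)))
  keeps-split y = trans
    (χ-keeps (isMin y) (isMin (f y)) (ascentIn y) (ascent y (f y)) (ascentOut (f y)) (ascentOut y) (ascentOut-min y) (ascentOut-nonMin y))
    (cong (λ b → χ (isMin (f y)) + (χ (peak y) + χ (not (isMin (f y)) ∧ (b ∧ not (ascentOut (f y))))))
          (sym (ascentIn-next y)))

  ∑χ : (Fin n → Bool) → ℕ
  ∑χ b = ∑ n (λ y → χ (b y))

  #cycleEntries≡#cycleExits : ∑χ (λ x → not (isMin x) ∧ isMin (f x)) ≡ ∑χ (λ x → isMin x ∧ not (isMin (f x)))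
  #cycleEntries≡#cycleExits = NP.+-cancelˡ-≡ (∑χ (λ x → isMin x ∧ isMin (f x))) _ _ (begin
    ∑χ (λ x → isMin x ∧ isMin (f x)) + ∑χ (λ x → not (isMin x) ∧ isMin (f x))   ≡⟨ sym (∑-+ n _ _) ⟩
    ∑ n (λ x → χ (isMin x ∧ isMin (f x)) + χ (not (isMin x) ∧ isMin (f x)))     ≡⟨ ∑-cong n (λ x → sym (χ-splitˡ (isMin x) (isMin (f x)))) ⟩
    ∑ n (λ x → χ (isMin (f x)))                                                 ≡⟨ ∑-reindex (λ x → χ (isMin x)) ⟩
    ∑ n (λ x → χ (isMin x))                                                     ≡⟨ ∑-cong n (λ x → χ-splitʳ (isMin x) (isMin (f x))) ⟩
    ∑ n (λ x → χ (isMin x ∧ isMin (f x)) + χ (isMin x ∧ not (isMin (f x))))     ≡⟨ ∑-+ n _ _ ⟩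
    ∑χ (λ x → isMin x ∧ isMin (f x)) + ∑χ (λ x → isMin x ∧ not (isMin (f x)))   ∎)

  -- Ascents into a letter and ascents out of a letter are equinumerous
  -- (an ascent out of y is an ascent into f y, up to the minima and ∞).
  #ascentsIn≡#ascentsOut : ∑χ (λ y → not (isMin y) ∧ ascentIn y) ≡ ∑χ (λ y → not (isMin y) ∧ ascentOut y)
  #ascentsIn≡#ascentsOut = begin
    ∑χ (λ y → not (isMin y) ∧ ascentIn y)                ≡⟨ sym (∑-reindex (λ y → χ (not (isMin y) ∧ ascentIn y))) ⟩
    ∑ n (λ x → χ (not (isMin (f x)) ∧ ascentIn (f x)))   ≡⟨ ∑-cong n (λ x → cong (λ b → χ (not (isMin (f x)) ∧ b)) (ascentIn-next x)) ⟩
    ∑χ (λ x → not (isMin (f x)) ∧ ascent x (f x))        ≡⟨ NP.+-cancelʳ-≡ _ _ _ withEntries ⟩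
    ∑χ (λ y → not (isMin y) ∧ ascentOut y)               ∎
    where
    entries : ℕ
    entries = ∑χ (λ x → not (isMin x) ∧ isMin (f x))
    withEntries : ∑χ (λ x → not (isMin (f x)) ∧ ascent x (f x)) + entries ≡ ∑χ (λ y → not (isMin y) ∧ ascentOut y) + entries
    withEntries = begin
      ∑χ (λ x → not (isMin (f x)) ∧ ascent x (f x)) + entries                              ≡⟨ sym (∑-+ n _ _) ⟩
      ∑ n (λ x → χ (not (isMin (f x)) ∧ ascent x (f x)) + χ (not (isMin x) ∧ isMin (f x)))
        ≡⟨ ∑-cong n (λ x → χ-ascent-shift (isMin x) (isMin (f x)) (ascent x (f x)) (ascentOut x) (ascentOut-min x) (ascentOut-nonMin x)
                             (λ a b → <ᵇ-true (isMin-ascends x a b))) ⟩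
      ∑ n (λ x → χ (not (isMin x) ∧ ascentOut x) + χ (isMin x ∧ not (isMin (f x))))        ≡⟨ ∑-+ n _ _ ⟩
      ∑χ (λ y → not (isMin y) ∧ ascentOut y) + ∑χ (λ x → isMin x ∧ not (isMin (f x)))      ≡⟨ cong (∑χ (λ y → not (isMin y) ∧ ascentOut y) +_) (sym #cycleEntries≡#cycleExits) ⟩
      ∑χ (λ y → not (isMin y) ∧ ascentOut y) + entries                                     ∎

  #peaks≡#valleys : ∑χ peak ≡ ∑χ valley
  #peaks≡#valleys = NP.+-cancelʳ-≡ _ _ _ (begin
    ∑χ peak + ∑χ (λ y → not (isMin y) ∧ ascentOut y)             ≡⟨ sym (∑-+ n _ _) ⟩
    ∑ n (λ y → χ (peak y) + χ (not (isMin y) ∧ ascentOut y))     ≡⟨ ∑-cong n (λ y → χ-peak-valley (isMin y) (ascentIn y) (ascentOut y)) ⟩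
    ∑ n (λ y → χ (not (isMin y) ∧ ascentIn y) + χ (valley y))    ≡⟨ ∑-+ n _ _ ⟩
    ∑χ (λ y → not (isMin y) ∧ ascentIn y) + ∑χ valley            ≡⟨ cong (_+ ∑χ valley) #ascentsIn≡#ascentsOut ⟩
    ∑χ (λ y → not (isMin y) ∧ ascentOut y) + ∑χ valley           ≡⟨ NP.+-comm _ (∑χ valley) ⟩
    ∑χ valley + ∑χ (λ y → not (isMin y) ∧ ascentOut y)           ∎)

  ∑keeps≡crun : ∑χ keeps ≡ crun v
  ∑keeps≡crun = begin
    ∑χ keeps                                                        ≡⟨ ∑-cong n keeps-split ⟩
    ∑ n (λ y → χ (isMin (f y)) + (χ (peak y) + χ (peak (f y))))     ≡⟨ ∑-+ n _ _ ⟩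
    ∑ n (λ y → χ (isMin (f y))) + ∑ n (λ y → χ (peak y) + χ (peak (f y)))
      ≡⟨ cong₂ _+_ (∑-reindex (λ y → χ (isMin y))) (∑-+ n _ _) ⟩
    ∑χ isMin + (∑χ peak + ∑ n (λ y → χ (peak (f y))))
      ≡⟨ cong (λ z → ∑χ isMin + (∑χ peak + z)) (trans (∑-reindex (λ y → χ (peak y))) #peaks≡#valleys) ⟩
    ∑χ isMin + (∑χ peak + ∑χ valley)                                ≡⟨ cong (∑χ isMin +_) (sym (∑-+ n _ _)) ⟩
    ∑χ isMin + ∑ n (λ y → χ (peak y) + χ (valley y))                ≡⟨ sym (∑-+ n _ _) ⟩
    ∑ n (λ y → χ (isMin y) + (χ (peak y) + χ (valley y)))           ≡⟨ ∑-cong n (λ y → sym (localRuns-split y)) ⟩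
    ∑ n localRuns                                                   ≡⟨ sym crun≡∑localRuns ⟩
    crun v                                                          ∎

  ∑notKeeps≡n∸crun : ∑χ (λ y → not (keeps y)) ≡ n ∸ crun v
  ∑notKeeps≡n∸crun = begin
    ∑χ (λ y → not (keeps y))                          ≡⟨ sym (NP.m+n∸m≡n (crun v) _) ⟩
    crun v + ∑χ (λ y → not (keeps y)) ∸ crun v        ≡⟨ cong (λ z → z + ∑χ (λ y → not (keeps y)) ∸ crun v) (sym ∑keeps≡crun) ⟩
    ∑χ keeps + ∑χ (λ y → not (keeps y)) ∸ crun v      ≡⟨ cong (_∸ crun v) (sym (∑-+ n _ _)) ⟩
    ∑ n (λ y → χ (keeps y) + χ (not (keeps y))) ∸ crun v ≡⟨ cong (_∸ crun v) (trans (∑-cong n (λ y → χ+χ-not (keeps y))) (∑-1 n)) ⟩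
    n ∸ crun v                                        ∎

  crun≤n : crun v ≤ n
  crun≤n = subst (_≤ n) ∑keeps≡crun (subst (∑χ keeps ≤_) (∑-1 n) (∑-mono n _ _ (λ y → χ≤1 (keeps y))))
    where
    χ≤1 : ∀ b → χ b ≤ 1
    χ≤1 true = s≤s z≤n
    χ≤1 false = z≤n

-- Inserting the new letter n+1 into a permutation of [n]

lower? : ∀ {n} → Fin (suc n) → Maybe (Fin n)
lower? {zero} F.zero = nothing
lower? {suc n} F.zero = just F.zero
lower? {suc n} (F.suc i) = Maybe.map F.suc (lower? i)

lower?-inject₁ : ∀ {n} (x : Fin n) → lower? (inject₁ x) ≡ just x
lower?-inject₁ {suc n} F.zero = refl
lower?-inject₁ {suc n} (F.suc x) rewrite lower?-inject₁ x = refl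

lower?-fromℕ : ∀ n → lower? (fromℕ n) ≡ nothing
lower?-fromℕ zero = refl
lower?-fromℕ (suc n) rewrite lower?-fromℕ n = refl

lastView : ∀ {n} (z : Fin (suc n)) → (Σ (Fin n) λ x → z ≡ inject₁ x) ⊎ (z ≡ fromℕ n)
lastView {zero} F.zero = inj₂ refl
lastView {suc n} F.zero = inj₁ (F.zero , refl)
lastView {suc n} (F.suc i) with lastView i
... | inj₁ (x , e) = inj₁ (F.suc x , cong F.suc e)
... | inj₂ e = inj₂ (cong F.suc e)

N≢inject₁ : ∀ {n} {x : Fin n} → ¬ fromℕ n ≡ inject₁ x
N≢inject₁ {x = x} = FP.fromℕ≢inject₁ {i = x}

inject₁≢N : ∀ {n} {x : Fin n} → ¬ inject₁ x ≡ fromℕ n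
inject₁≢N e = N≢inject₁ (sym e)

-- insert v y: for y = n (fromℕ n) add the fixed point n; for an old letter y
-- send y ↦ n ↦ v(y) and leave everything else as in v.
insertAt : ∀ {n} → (Fin n → Fin n) → Maybe (Fin n) → Maybe (Fin n) → Fin (suc n)
insertAt f nothing (just x) = inject₁ (f x)
insertAt {n} f nothing nothing = fromℕ n
insertAt {n} f (just y0) (just x) = if x == y0 then fromℕ n else inject₁ (f x)
insertAt f (just y0) nothing = inject₁ (f y0)

insert : ∀ {n} → Perm n → Fin (suc n) → Perm (suc n)
insert v y = tabulate (λ z → insertAt (app v) (lower? y) (lower? z))

app-insert : ∀ {n} (v : Perm n) y z → app (insert v y) z ≡ insertAt (app v) (lower? y) (lower? z)
app-insert v y z = VP.lookup∘tabulate (λ z → insertAt (app v) (lower? y) (lower? z)) z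

module InsertNew {n} (v : Perm n) where
  N : Fin (suc n)
  N = fromℕ n

  new↦new : app (insert v N) N ≡ N
  new↦new rewrite app-insert v N N | lower?-fromℕ n = refl

  old↦old : ∀ x → app (insert v N) (inject₁ x) ≡ inject₁ (app v x)
  old↦old x rewrite app-insert v N (inject₁ x) | lower?-fromℕ n | lower?-inject₁ x = refl

module InsertAfter {n} (v : Perm n) (y0 : Fin n) where
  N : Fin (suc n)
  N = fromℕ n
  y : Fin (suc n)
  y = inject₁ y0

  new↦next : app (insert v y) N ≡ inject₁ (app v y0)
  new↦next rewrite app-insert v y N | lower?-fromℕ n | lower?-inject₁ y0 = refl

  old↦ : ∀ x → app (insert v y) (inject₁ x) ≡ (if x == y0 then N else inject₁ (app v x))
  old↦ x rewrite app-insert v y (inject₁ x) | lower?-inject₁ y0 | lower?-inject₁ x = refl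

  y0↦new : app (insert v y) y ≡ N
  y0↦new rewrite old↦ y0 | ==-refl y0 = refl

  old↦old : ∀ x → ¬ x ≡ y0 → app (insert v y) (inject₁ x) ≡ inject₁ (app v x)
  old↦old x ne rewrite old↦ x | ==-false {i = x} {j = y0} ne = refl

insert-Inj : ∀ {n} (v : Perm n) → Inj v → ∀ y → Inj (insert v y)
insert-Inj {n} v iv y a b eq with lastView y
... | inj₂ refl = injNew (lastView a) (lastView b)
  where
  open InsertNew v
  injNew : _ → _ → a ≡ b
  injNew (inj₁ (x , refl)) (inj₁ (x' , refl)) =
    cong inject₁ (iv x x' (FP.inject₁-injective (trans (sym (old↦old x)) (trans eq (old↦old x')))))
  injNew (inj₁ (x , refl)) (inj₂ refl) = ⊥-elim (inject₁≢N (trans (sym (old↦old x)) (trans eq new↦new)))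
  injNew (inj₂ refl) (inj₁ (x' , refl)) = ⊥-elim (N≢inject₁ (trans (sym new↦new) (trans eq (old↦old x'))))
  injNew (inj₂ refl) (inj₂ refl) = refl
... | inj₁ (y0 , refl) = injAfter (lastView a) (lastView b)
  where
  open InsertAfter v y0 hiding (y)
  w : Perm (suc n)
  w = insert v (inject₁ y0)
  oldStep : ∀ x → (x ≡ y0 × app w (inject₁ x) ≡ N) ⊎ (¬ x ≡ y0 × app w (inject₁ x) ≡ inject₁ (app v x))
  oldStep x with x == y0 in e
  ... | true = inj₁ (==-true e , trans (old↦ x) (cong (λ b → if b then N else inject₁ (app v x)) e))
  ... | false = inj₂ (==-false⇒≢ e , old↦old x (==-false⇒≢ e))
  injAfter : _ → _ → a ≡ b
  injAfter (inj₁ (x , refl)) (inj₁ (x' , refl)) with oldStep x | oldStep x'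
  ... | inj₁ (e1 , _) | inj₁ (e2 , _) = cong inject₁ (trans e1 (sym e2))
  ... | inj₁ (_ , w1) | inj₂ (_ , w2) = ⊥-elim (N≢inject₁ (trans (sym w1) (trans eq w2)))
  ... | inj₂ (_ , w1) | inj₁ (_ , w2) = ⊥-elim (inject₁≢N (trans (sym w1) (trans eq w2)))
  ... | inj₂ (_ , w1) | inj₂ (_ , w2) = cong inject₁ (iv x x' (FP.inject₁-injective (trans (sym w1) (trans eq w2))))
  injAfter (inj₁ (x , refl)) (inj₂ refl) with oldStep x
  ... | inj₁ (_ , w1) = ⊥-elim (N≢inject₁ (trans (sym w1) (trans eq new↦next)))
  ... | inj₂ (ne , w1) = ⊥-elim (ne (iv x y0 (FP.inject₁-injective (trans (sym w1) (trans eq new↦next)))))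
  injAfter (inj₂ refl) (inj₁ (x' , refl)) with oldStep x'
  ... | inj₁ (_ , w2) = ⊥-elim (inject₁≢N (trans (sym new↦next) (trans eq w2)))
  ... | inj₂ (ne , w2) = ⊥-elim (ne (sym (iv y0 x' (FP.inject₁-injective (trans (sym new↦next) (trans eq w2))))))
  injAfter (inj₂ refl) (inj₂ refl) = refl

-- The effect of insertion on crun and cyc

turn-∞ : ∀ a b n m c → b < n → turn a b (if m then suc n else c) ≡ turn a b (if m then n else c)
turn-∞ a b n true c b<n rewrite <ᵇ-true b<n | <ᵇ-true (NP.m<n⇒m<1+n b<n) = refl
turn-∞ a b n false c b<n = refl

-- The turns at y, n and z after inserting n between y and z = f y, against
-- those at y and z before: they agree up to the correction 0 or 2 predicted
-- by keeps y.  Here p = pred y, s and s' = next z (with ∞ = n resp. n+1).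
turns-insertAfter : ∀ (p y z s s' n : ℕ) (mY mZ : Bool) → y < n → z < n →
  (mY ≡ true → mZ ≡ false → y < z) → (z <ᵇ s') ≡ (z <ᵇ s) →
  (if mY then 1 else turn p y n) + (if mZ then 1 else turn n z s') + turn y n (if mZ then suc n else z)
  ≡ (if mY then 1 else turn p y (if mZ then n else z)) + (if mZ then 1 else turn y z s)
    + (if (if mZ then true else ((not mY ∧ ((p <ᵇ y) ∧ not (y <ᵇ z))) ∨ ((y <ᵇ z) ∧ not (z <ᵇ s)))) then 0 else 2)
turns-insertAfter p y z s s' n mY true y<n z<n h hs
  rewrite <ᵇ-true y<n | <ᵇ-true (NP.n<1+n n) = refl
turns-insertAfter p y z s s' n mY false y<n z<n h hs
  rewrite <ᵇ-true y<n | <ᵇ-false z<n | hs with mY | p <ᵇ y | y <ᵇ z in eyz | z <ᵇ s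
... | true | _ | false | _ = ⊥-elim (f≢t (trans (sym eyz) (<ᵇ-true (h refl refl))))
... | true | _ | true | true = refl
... | true | _ | true | false = refl
... | false | true | true | true = refl
... | false | true | true | false = refl
... | false | true | false | true = refl
... | false | true | false | false = refl
... | false | false | true | true = refl
... | false | false | true | false = refl
... | false | false | false | true = refl
... | false | false | false | false = refl

+-exchange : ∀ a b c d x y → a + x ≡ b + y → y + c ≡ x + d → a + c ≡ b + d
+-exchange a b c d x y e1 e2 = NP.+-cancelʳ-≡ x _ _ (begin
  a + c + x    ≡⟨ NP.+-assoc a c x ⟩
  a + (c + x)  ≡⟨ cong (a +_) (NP.+-comm c x) ⟩
  a + (x + c)  ≡⟨ sym (NP.+-assoc a x c) ⟩
  a + x + c    ≡⟨ cong (_+ c) e1 ⟩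
  b + y + c    ≡⟨ NP.+-assoc b y c ⟩
  b + (y + c)  ≡⟨ cong (b +_) e2 ⟩
  b + (x + d)  ≡⟨ cong (b +_) (NP.+-comm x d) ⟩
  b + (d + x)  ≡⟨ sym (NP.+-assoc b d x) ⟩
  b + d + x    ∎)

-- For w = insert v y: the old letters keep their cycles (with n possibly
-- spliced in), so old minima stay minima, and a letter whose neighbours are
-- untouched keeps its local contribution.
module InsertionEffect {n} (v : Perm n) (iv : Inj v) (y : Fin (suc n)) where
  w : Perm (suc n)
  w = insert v y

  iw : Inj w
  iw = insert-Inj v iv y

  module Vc = RunStatistics v iv
  module Wc = RunStatistics w iw

  f : Fin n → Fin n
  f = app v
  g : Fin (suc n) → Fin (suc n)
  g = app w

  N : Fin (suc n)
  N = fromℕ n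

  ι1 : Fin n → Fin (suc n)
  ι1 = inject₁

  toℕ-N : toℕ N ≡ n
  toℕ-N = FP.toℕ-fromℕ n

  toℕ-ι1 : ∀ x → toℕ (ι1 x) ≡ toℕ x
  toℕ-ι1 = FP.toℕ-inject₁

  insert-step : ∀ z → (g (ι1 z) ≡ ι1 (f z)) ⊎ (g (ι1 z) ≡ N × y ≡ ι1 z)
  insert-step z with lastView y
  ... | inj₂ eN = inj₁ (trans (cong (λ q → app (insert v q) (ι1 z)) eN) (InsertNew.old↦old v z))
  ... | inj₁ (y0 , e0) with z == y0 in e
  ...   | true = inj₂ (trans (cong (λ q → app (insert v q) (ι1 z)) e0)
                        (trans (InsertAfter.old↦ v y0 z) (cong (λ b → if b then N else ι1 (f z)) e)) ,
                     trans e0 (cong ι1 (sym (==-true {i = z} {j = y0} e))))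
  ...   | false = inj₁ (trans (cong (λ q → app (insert v q) (ι1 z)) e0)
                    (InsertAfter.old↦old v y0 z (==-false⇒≢ e)))

  new↦next : ∀ z → y ≡ ι1 z → g N ≡ ι1 (f z)
  new↦next z e = trans (cong (λ q → app (insert v q) N) e) (InsertAfter.new↦next v z)

  iter-forward : ∀ x u → Σ ℕ λ t → Wc.iter t (ι1 x) ≡ ι1 (Vc.iter u x)
  iter-forward x zero = 0 , refl
  iter-forward x (suc u) with iter-forward x u
  ... | t , e with insert-step (Vc.iter u x)
  ...   | inj₁ s = suc t , trans (cong g e) s
  ...   | inj₂ (s , yz) = suc (suc t) , trans (cong g (trans (cong g e) s)) (new↦next _ yz)

  iter-backward : ∀ x t → (Σ ℕ λ u → Wc.iter t (ι1 x) ≡ ι1 (Vc.iter u x))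
                        ⊎ (Wc.iter t (ι1 x) ≡ N × Σ ℕ λ u → y ≡ ι1 (Vc.iter u x))
  iter-backward x zero = inj₁ (0 , refl)
  iter-backward x (suc t) with iter-backward x t
  ... | inj₁ (u , e) with insert-step (Vc.iter u x)
  ...   | inj₁ s = inj₁ (suc u , trans (cong g e) s)
  ...   | inj₂ (s , yz) = inj₂ (trans (cong g e) s , u , yz)
  iter-backward x (suc t) | inj₂ (e , u , yz) = inj₁ (suc u , trans (cong g e) (new↦next _ yz))

  isMin-lift : ∀ x → Wc.isMin (ι1 x) ≡ Vc.isMin x
  isMin-lift x with Vc.isMin x in e
  ... | true = Wc.≤⇒isMin (ι1 x) below
    where
    below : ∀ t → toℕ (ι1 x) ≤ toℕ (Wc.iter t (ι1 x))
    below t with iter-backward x t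
    ... | inj₁ (u , e') rewrite e' | toℕ-ι1 x | toℕ-ι1 (Vc.iter u x) = Vc.isMin⇒≤ x e u
    ... | inj₂ (e' , _) rewrite e' | toℕ-ι1 x | toℕ-N = NP.<⇒≤ (FP.toℕ<n x)
  ... | false with Wc.isMin (ι1 x) in e2
  ...   | false = refl
  ...   | true = ⊥-elim (f≢t (trans (sym e) (Vc.≤⇒isMin x below)))
    where
    below : ∀ u → toℕ x ≤ toℕ (Vc.iter u x)
    below u with iter-forward x u
    ... | t , e' with Wc.isMin⇒≤ (ι1 x) e2 t
    ...   | le rewrite e' | toℕ-ι1 x | toℕ-ι1 (Vc.iter u x) = le

  localRuns-lift : ∀ x → g (ι1 (Vc.pred x)) ≡ ι1 x → g (ι1 x) ≡ ι1 (f x) → Wc.localRuns (ι1 x) ≡ Vc.localRuns x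
  localRuns-lift x gp gx = begin
    Wc.localRuns (ι1 x)
      ≡⟨ Wc.localRuns-eqn (ι1 x) (isMin-lift x) (trans (cong toℕ (Wc.pred-uniq gp)) (toℕ-ι1 _)) (toℕ-ι1 x) next ⟩
    (if Vc.isMin x then 1 else turn (toℕ (Vc.pred x)) (toℕ x) (if Vc.isMin (f x) then suc n else toℕ (f x)))
      ≡⟨ cong (λ c → if Vc.isMin x then 1 else c) (turn-∞ _ _ n (Vc.isMin (f x)) _ (FP.toℕ<n x)) ⟩
    Vc.localRuns x ∎
    where
    next : Wc.succOr∞ (ι1 x) ≡ (if Vc.isMin (f x) then suc n else toℕ (f x))
    next = Wc.succOr∞-eqn (ι1 x) (trans (cong Wc.isMin gx) (isMin-lift (f x))) (trans (cong toℕ gx) (toℕ-ι1 (f x)))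

  cyc-insert : cyc w ≡ cyc v + χ (Wc.isMin N)
  cyc-insert = begin
    cyc w                                              ≡⟨ Wc.cyc≡∑isMin ⟩
    ∑ (suc n) (λ z → χ (Wc.isMin z))                   ≡⟨ ∑-last n (λ z → χ (Wc.isMin z)) ⟩
    ∑ n (λ x → χ (Wc.isMin (ι1 x))) + χ (Wc.isMin N)   ≡⟨ cong (_+ χ (Wc.isMin N)) (∑-cong n (λ x → cong χ (isMin-lift x))) ⟩
    ∑ n (λ x → χ (Vc.isMin x)) + χ (Wc.isMin N)        ≡⟨ cong (_+ χ (Wc.isMin N)) (sym Vc.cyc≡∑isMin) ⟩
    cyc v + χ (Wc.isMin N)                             ∎

  crun-insert : crun w ≡ ∑ n (λ x → Wc.localRuns (ι1 x)) + Wc.localRuns N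
  crun-insert = trans Wc.crun≡∑localRuns (∑-last n Wc.localRuns)

  module NewFixedPoint (eN : y ≡ N) where
    gN : g N ≡ N
    gN = trans (cong (λ q → app (insert v q) N) eN) (InsertNew.new↦new v)

    gOld : ∀ x → g (ι1 x) ≡ ι1 (f x)
    gOld x = trans (cong (λ q → app (insert v q) (ι1 x)) eN) (InsertNew.old↦old v x)

    minN : Wc.isMin N ≡ true
    minN = Wc.fixedPoint-isMin N gN

    crun-newFixed : crun w ≡ suc (crun v)
    crun-newFixed = begin
      crun w                                             ≡⟨ crun-insert ⟩
      ∑ n (λ x → Wc.localRuns (ι1 x)) + Wc.localRuns N   ≡⟨ cong₂ _+_ (∑-cong n lift) (Wc.localRuns-min N minN) ⟩
      ∑ n Vc.localRuns + 1                               ≡⟨ NP.+-comm _ 1 ⟩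
      suc (∑ n Vc.localRuns)                             ≡⟨ cong suc (sym Vc.crun≡∑localRuns) ⟩
      suc (crun v)                                       ∎
      where
      lift : ∀ x → Wc.localRuns (ι1 x) ≡ Vc.localRuns x
      lift x = localRuns-lift x (trans (gOld (Vc.pred x)) (cong ι1 (Vc.f-pred x))) (gOld x)

    cyc-newFixed : cyc w ≡ suc (cyc v)
    cyc-newFixed = trans cyc-insert (trans (cong (λ b → cyc v + χ b) minN) (NP.+-comm (cyc v) 1))

  module AfterOld (y0 : Fin n) (e0 : y ≡ inject₁ y0) where
    z0 : Fin n
    z0 = f y0

    gy0 : g (ι1 y0) ≡ N
    gy0 = trans (cong (λ q → app (insert v q) (ι1 y0)) e0) (InsertAfter.y0↦new v y0)

    gOld : ∀ x → ¬ x ≡ y0 → g (ι1 x) ≡ ι1 (f x)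
    gOld x ne = trans (cong (λ q → app (insert v q) (ι1 x)) e0) (InsertAfter.old↦old v y0 x ne)

    gN : g N ≡ ι1 z0
    gN = new↦next y0 e0

    -- n is not a minimum: it is followed by the smaller letter z0.
    minN : Wc.isMin N ≡ false
    minN with Wc.isMin N in e
    ... | false = refl
    ... | true = ⊥-elim (NP.<⇒≱ z0<N (Wc.isMin⇒≤ N e 1))
      where
      z0<N : toℕ (Wc.iter 1 N) < toℕ N
      z0<N rewrite gN | toℕ-ι1 z0 | toℕ-N = FP.toℕ<n z0

    predN : Wc.pred N ≡ ι1 y0
    predN = Wc.pred-uniq gy0

    pred≢y0 : ∀ x → ¬ x ≡ z0 → ¬ Vc.pred x ≡ y0
    pred≢y0 x nz q = nz (trans (sym (Vc.f-pred x)) (cong f q))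

    gPred : ∀ x → ¬ x ≡ z0 → g (ι1 (Vc.pred x)) ≡ ι1 x
    gPred x nz = trans (gOld (Vc.pred x) (pred≢y0 x nz)) (cong ι1 (Vc.f-pred x))

    lift : ∀ x → ¬ x ≡ y0 → ¬ x ≡ z0 → Wc.localRuns (ι1 x) ≡ Vc.localRuns x
    lift x ny nz = localRuns-lift x (gPred x nz) (gOld x ny)

    cyc-after : cyc w ≡ cyc v
    cyc-after = trans cyc-insert (trans (cong (λ b → cyc v + χ b) minN) (NP.+-identityʳ (cyc v)))

    Δ : ℕ
    Δ = if Vc.keeps y0 then 0 else 2

    contributions : ¬ z0 ≡ y0 →
      Wc.localRuns (ι1 y0) + Wc.localRuns (ι1 z0) + Wc.localRuns N ≡ Vc.localRuns y0 + Vc.localRuns z0 + Δ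
    contributions nz = begin
      Wc.localRuns (ι1 y0) + Wc.localRuns (ι1 z0) + Wc.localRuns N
        ≡⟨ cong₂ _+_ (cong₂ _+_ atY atZ) atN ⟩
      (if mY then 1 else turn p (toℕ y0) n) + (if mZ then 1 else turn n (toℕ z0) s') + turn (toℕ y0) n (if mZ then suc n else toℕ z0)
        ≡⟨ turns-insertAfter p (toℕ y0) (toℕ z0) (Vc.succOr∞ z0) s' n mY mZ (FP.toℕ<n y0) (FP.toℕ<n z0)
             (Vc.isMin-ascends y0) (sameAscent (Vc.isMin (f z0)) (FP.toℕ<n z0)) ⟩
      Vc.localRuns y0 + (if mZ then 1 else turn (toℕ y0) (toℕ z0) (Vc.succOr∞ z0)) + Δ
        ≡⟨ cong (λ k → Vc.localRuns y0 + k + Δ) (sym (Vc.localRuns-eqn z0 refl (cong toℕ (Vc.pred-f y0)) refl refl)) ⟩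
      Vc.localRuns y0 + Vc.localRuns z0 + Δ ∎
      where
      mY : Bool
      mY = Vc.isMin y0
      mZ : Bool
      mZ = Vc.isMin z0
      p : ℕ
      p = toℕ (Vc.pred y0)
      s' : ℕ
      s' = if Vc.isMin (f z0) then suc n else toℕ (f z0)
      atY : Wc.localRuns (ι1 y0) ≡ (if mY then 1 else turn p (toℕ y0) n)
      atY = Wc.localRuns-eqn (ι1 y0) (isMin-lift y0)
        (trans (cong toℕ (Wc.pred-uniq (gPred y0 (λ q → nz (sym q))))) (toℕ-ι1 _))
        (toℕ-ι1 y0) (Wc.succOr∞-eqn (ι1 y0) (trans (cong Wc.isMin gy0) minN) (trans (cong toℕ gy0) toℕ-N))
      atZ : Wc.localRuns (ι1 z0) ≡ (if mZ then 1 else turn n (toℕ z0) s')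
      atZ = Wc.localRuns-eqn (ι1 z0) (isMin-lift z0) (trans (cong toℕ (Wc.pred-uniq gN)) toℕ-N) (toℕ-ι1 z0)
        (Wc.succOr∞-eqn (ι1 z0) (trans (cong Wc.isMin (gOld z0 nz)) (isMin-lift (f z0))) (trans (cong toℕ (gOld z0 nz)) (toℕ-ι1 (f z0))))
      atN : Wc.localRuns N ≡ turn (toℕ y0) n (if mZ then suc n else toℕ z0)
      atN = Wc.localRuns-eqn N minN (trans (cong toℕ predN) (toℕ-ι1 y0)) toℕ-N
        (Wc.succOr∞-eqn N (trans (cong Wc.isMin gN) (isMin-lift z0)) (trans (cong toℕ gN) (toℕ-ι1 z0)))
      sameAscent : ∀ m {c b} → b < n → (b <ᵇ (if m then suc n else c)) ≡ (b <ᵇ (if m then n else c))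
      sameAscent true b<n = trans (<ᵇ-true (NP.m<n⇒m<1+n b<n)) (sym (<ᵇ-true b<n))
      sameAscent false b<n = refl

    contributions-fixed : z0 ≡ y0 → Wc.localRuns (ι1 y0) + Wc.localRuns N ≡ Vc.localRuns y0 + Δ
    contributions-fixed fz = begin
      Wc.localRuns (ι1 y0) + Wc.localRuns N ≡⟨ cong₂ _+_ (Wc.localRuns-min (ι1 y0) (trans (isMin-lift y0) mY)) atN ⟩
      1 + 0                                 ≡⟨ cong₂ _+_ (sym (Vc.localRuns-min y0 mY)) (sym Δ≡0) ⟩
      Vc.localRuns y0 + Δ                   ∎
      where
      mY : Vc.isMin y0 ≡ true
      mY = Vc.fixedPoint-isMin y0 fz
      Δ≡0 : Δ ≡ 0
      Δ≡0 rewrite trans (cong Vc.isMin fz) mY = refl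
      atN : Wc.localRuns N ≡ 0
      atN = trans (Wc.localRuns-eqn N minN (trans (cong toℕ predN) (toℕ-ι1 y0)) toℕ-N
                   (Wc.succOr∞-eqn N (trans (cong Wc.isMin gN) (trans (isMin-lift z0) (trans (cong Vc.isMin fz) mY))) refl))
                  noTurn
        where
        noTurn : turn (toℕ y0) n (suc n) ≡ 0
        noTurn rewrite <ᵇ-true (FP.toℕ<n y0) | <ᵇ-true (NP.n<1+n n) = refl

    crun-after : crun w ≡ crun v + Δ
    crun-after = trans crun-insert (trans (byCases (z0 FP.≟ y0)) (cong (_+ Δ) (sym Vc.crun≡∑localRuns)))
      where
      ∑W : ℕ
      ∑W = ∑ n (λ x → Wc.localRuns (ι1 x))
      byCases : Dec (z0 ≡ y0) → ∑W + Wc.localRuns N ≡ ∑ n Vc.localRuns + Δ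
      byCases (yes fz) = +-exchange ∑W (∑ n Vc.localRuns) (Wc.localRuns N) Δ (Vc.localRuns y0) (Wc.localRuns (ι1 y0))
        (∑-exchange₁ n (λ x → Wc.localRuns (ι1 x)) Vc.localRuns y0 (λ x ne → lift x ne (λ q → ne (trans q fz))))
        (contributions-fixed fz)
      byCases (no nz) = +-exchange ∑W (∑ n Vc.localRuns) (Wc.localRuns N) Δ
        (Vc.localRuns y0 + Vc.localRuns z0) (Wc.localRuns (ι1 y0) + Wc.localRuns (ι1 z0))
        (∑-exchange₂ n (λ x → Wc.localRuns (ι1 x)) Vc.localRuns y0 z0 (λ q → nz (sym q)) lift)
        (contributions nz)

-- The bijection S_n × [n+1] ≅ S_{n+1}

isPerm : ∀ {n} → Perm n → Bool
isPerm {n} v = does (UniqueDec.unique? (FP._≟_ {n}) (toList v))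

allLookup : ∀ {n k} {P : Fin n → Set} (vs : Vec (Fin n) k) → All.All P (toList vs) → ∀ j → P (lookup vs j)
allLookup (x V.∷ vs) (px All.∷ _) F.zero = px
allLookup (x V.∷ vs) (_ All.∷ pxs) (F.suc j) = allLookup vs pxs j

lookupAll : ∀ {n k} {P : Fin n → Set} (vs : Vec (Fin n) k) → (∀ j → P (lookup vs j)) → All.All P (toList vs)
lookupAll V.[] h = All.[]
lookupAll (x V.∷ vs) h = h F.zero All.∷ lookupAll vs (λ j → h (F.suc j))

LookupInjective : ∀ {n k} (vs : Vec (Fin n) k) → Set
LookupInjective {k = k} vs = ∀ (a b : Fin k) → lookup vs a ≡ lookup vs b → a ≡ b

distinct⇒injective : ∀ {n k} (vs : Vec (Fin n) k) → AP.AllPairs (λ x y → ¬ x ≡ y) (toList vs) → LookupInjective vs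
distinct⇒injective (x V.∷ vs) (ha AP.∷ hu) F.zero F.zero e = refl
distinct⇒injective (x V.∷ vs) (ha AP.∷ hu) F.zero (F.suc b) e = ⊥-elim (allLookup vs ha b e)
distinct⇒injective (x V.∷ vs) (ha AP.∷ hu) (F.suc a) F.zero e = ⊥-elim (allLookup vs ha a (sym e))
distinct⇒injective (x V.∷ vs) (ha AP.∷ hu) (F.suc a) (F.suc b) e = cong F.suc (distinct⇒injective vs hu a b e)

injective⇒distinct : ∀ {n k} (vs : Vec (Fin n) k) → LookupInjective vs → AP.AllPairs (λ x y → ¬ x ≡ y) (toList vs)
injective⇒distinct V.[] h = AP.[]
injective⇒distinct (x V.∷ vs) h =
  lookupAll vs (λ j e → zero≢suc (h F.zero (F.suc j) e)) AP.∷ injective⇒distinct vs (λ a b e → FP.suc-injective (h (F.suc a) (F.suc b) e))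
  where
  zero≢suc : ∀ {j} → ¬ F.zero ≡ F.suc j
  zero≢suc ()

isPerm⇒Inj : ∀ {n} (v : Perm n) → isPerm v ≡ true → Inj v
isPerm⇒Inj {n} v e with UniqueDec.unique? (FP._≟_ {n}) (toList v)
... | yes u = distinct⇒injective v u
... | no _ = ⊥-elim (f≢t e)

Inj⇒isPerm : ∀ {n} (v : Perm n) → Inj v → isPerm v ≡ true
Inj⇒isPerm {n} v i with UniqueDec.unique? (FP._≟_ {n}) (toList v)
... | yes _ = refl
... | no nu = ⊥-elim (nu (injective⇒distinct v i))

vecEq : ∀ {m k} → Vec (Fin m) k → Vec (Fin m) k → Bool
vecEq V.[] V.[] = true
vecEq (x V.∷ xs) (y V.∷ ys) = (x == y) ∧ vecEq xs ys

vecEq-true : ∀ {m k} (a b : Vec (Fin m) k) → vecEq a b ≡ true → a ≡ b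
vecEq-true V.[] V.[] _ = refl
vecEq-true (x V.∷ xs) (y V.∷ ys) e = cong₂ V._∷_ (==-true (∧-true₁ e)) (vecEq-true xs ys (∧-true₂ {x == y} e))

vecEq-refl : ∀ {m k} (a : Vec (Fin m) k) → vecEq a a ≡ true
vecEq-refl V.[] = refl
vecEq-refl (x V.∷ xs) rewrite ==-refl x = vecEq-refl xs

vec-ext : ∀ {n m} (a b : Vec (Fin m) n) → (∀ i → lookup a i ≡ lookup b i) → a ≡ b
vec-ext a b h = trans (sym (VP.tabulate∘lookup a)) (trans (VP.tabulate-cong h) (VP.tabulate∘lookup b))

allWords-δ : ∀ k m (a : Vec (Fin m) k) (h : Vec (Fin m) k → ℕ) → ∑ₗ (allWords k m) (λ w → χ (vecEq w a) * h w) ≡ h a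
allWords-δ zero m V.[] h = trans (NP.+-identityʳ _) (NP.+-identityʳ _)
allWords-δ (suc k) m (a0 V.∷ as) h = begin
  ∑ₗ (allWords (suc k) m) (λ w → χ (vecEq w (a0 V.∷ as)) * h w)
    ≡⟨ ∑ₗ-concatMap (λ i → map (i V.∷_) (allWords k m)) (allFin m) _ ⟩
  ∑ₗ (allFin m) (λ i → ∑ₗ (map (i V.∷_) (allWords k m)) (λ w → χ (vecEq w (a0 V.∷ as)) * h w))
    ≡⟨ ∑ₗ-cong (allFin m) (λ i → ∑ₗ-map (i V.∷_) (allWords k m) _) ⟩
  ∑ₗ (allFin m) (λ i → ∑ₗ (allWords k m) (λ ws → χ ((i == a0) ∧ vecEq ws as) * h (i V.∷ ws)))
    ≡⟨ ∑ₗ-cong (allFin m) (λ i → trans (∑ₗ-cong (allWords k m) (λ ws → χ-∧ (i == a0) (vecEq ws as) (h (i V.∷ ws))))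
                                       (∑ₗ-*ˡ (allWords k m) (χ (i == a0)) _)) ⟩
  ∑ₗ (allFin m) (λ i → χ (i == a0) * ∑ₗ (allWords k m) (λ ws → χ (vecEq ws as) * h (i V.∷ ws)))
    ≡⟨ ∑ₗ-allFin m _ ⟩
  ∑ m (λ i → χ (i == a0) * ∑ₗ (allWords k m) (λ ws → χ (vecEq ws as) * h (i V.∷ ws)))
    ≡⟨ ∑-δ m a0 (λ i → ∑ₗ (allWords k m) (λ ws → χ (vecEq ws as) * h (i V.∷ ws))) ⟩
  ∑ₗ (allWords k m) (λ ws → χ (vecEq ws as) * h (a0 V.∷ ws))
    ≡⟨ allWords-δ k m as (λ ws → h (a0 V.∷ ws)) ⟩
  h (a0 V.∷ as) ∎
  where
  χ-∧ : ∀ b c x → χ (b ∧ c) * x ≡ χ b * (χ c * x)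
  χ-∧ true c x = sym (NP.+-identityʳ _)
  χ-∧ false c x = refl

-- The inverse of insertion: the insertion point of w is w⁻¹(n), and delete w
-- removes n from its cycle.
insertionPoint : ∀ {n} (w : Perm (suc n)) → Inj w → Fin (suc n)
insertionPoint {n} w iw = Cycles.pred w iw (fromℕ n)

firstOld : ∀ {n} → Maybe (Fin n) → Maybe (Fin n) → Fin n → Fin n
firstOld (just u) _ _ = u
firstOld nothing (just a) _ = a
firstOld nothing nothing d = d

deleteMap : ∀ {n} → Perm (suc n) → Fin n → Fin n
deleteMap {n} w x = firstOld (lower? (app w (inject₁ x))) (lower? (app w (fromℕ n))) x

delete : ∀ {n} → Perm (suc n) → Perm n
delete w = tabulate (deleteMap w)

app-delete : ∀ {n} (w : Perm (suc n)) x → app (delete w) x ≡ deleteMap w x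
app-delete w x = VP.lookup∘tabulate (deleteMap w) x

module DeleteInsert {n} (v : Perm n) (iv : Inj v) (y : Fin (suc n)) where
  w : Perm (suc n)
  w = insert v y
  N : Fin (suc n)
  N = fromℕ n

  y↦N : app w y ≡ N
  y↦N with lastView y
  ... | inj₂ refl = InsertNew.new↦new v
  ... | inj₁ (y0 , refl) = InsertAfter.y0↦new v y0

  delete-insert : delete w ≡ v
  delete-insert = vec-ext (delete w) v (λ x → trans (app-delete w x) (pointwise x))
    where
    pointwise : ∀ x → deleteMap w x ≡ app v x
    pointwise x with lastView y
    ... | inj₂ refl rewrite InsertNew.old↦old v x | lower?-inject₁ (app v x) = refl
    ... | inj₁ (y0 , refl) with x == y0 in e
    ...   | true rewrite ==-true {i = x} {j = y0} e | InsertAfter.y0↦new v y0 | lower?-fromℕ n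
                       | InsertAfter.new↦next v y0 | lower?-inject₁ (app v y0) = refl
    ...   | false rewrite InsertAfter.old↦old v y0 x (==-false⇒≢ e) | lower?-inject₁ (app v x) = refl

insertAt-cong : ∀ {n} (f f' : Fin n → Fin n) → (∀ x → f x ≡ f' x) → ∀ a b → insertAt f a b ≡ insertAt f' a b
insertAt-cong f f' h nothing (just x) = cong inject₁ (h x)
insertAt-cong f f' h nothing nothing = refl
insertAt-cong f f' h (just y0) (just x) = cong (λ q → if x == y0 then fromℕ _ else inject₁ q) (h x)
insertAt-cong f f' h (just y0) nothing = cong inject₁ (h y0)

module InsertDelete {n} (w : Perm (suc n)) (iw : Inj w) where
  N : Fin (suc n)
  N = fromℕ n
  g : Fin (suc n) → Fin (suc n)
  g = app w
  y : Fin (suc n)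
  y = insertionPoint w iw

  y↦N : g y ≡ N
  y↦N = Cycles.f-pred w iw N

  old↦old : ∀ x → ¬ inject₁ x ≡ y → Σ (Fin n) λ u → g (inject₁ x) ≡ inject₁ u
  old↦old x ne with lastView (g (inject₁ x))
  ... | inj₁ (u , e) = u , e
  ... | inj₂ e = ⊥-elim (ne (iw _ _ (trans e (sym y↦N))))

  insert-delete : insert (delete w) y ≡ w
  insert-delete = vec-ext (insert (delete w) y) w (λ z → trans (app-insert (delete w) y z)
     (trans (insertAt-cong (app (delete w)) (deleteMap w) (app-delete w) (lower? y) (lower? z)) (pointwise z)))
    where
    pointwise : ∀ z → insertAt (deleteMap w) (lower? y) (lower? z) ≡ g z
    pointwise z with lastView (g N)
    pointwise z | inj₂ gN≡N with iw y N (trans y↦N (sym gN≡N))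
    ... | y≡N rewrite y≡N | lower?-fromℕ n with lastView z
    ...   | inj₂ refl rewrite lower?-fromℕ n = sym gN≡N
    ...   | inj₁ (x , refl) rewrite lower?-inject₁ x with old↦old x (λ q → N≢inject₁ (trans (sym y≡N) (sym q)))
    ...     | u , gu rewrite gu | lower?-inject₁ u = refl
    pointwise z | inj₁ (a , gN≡a) with lastView y
    ... | inj₂ y≡N = ⊥-elim (N≢inject₁ (trans (sym (trans (cong g (sym y≡N)) y↦N)) gN≡a))
    ... | inj₁ (y0 , y≡y0) =
      trans (cong (λ q → insertAt (deleteMap w) q (lower? z)) (trans (cong lower? y≡y0) (lower?-inject₁ y0))) (afterOld z)
      where
      y0↦N : g (inject₁ y0) ≡ N
      y0↦N = trans (cong g (sym y≡y0)) y↦N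
      afterOld : ∀ z → insertAt (deleteMap w) (just y0) (lower? z) ≡ g z
      afterOld z with lastView z
      ... | inj₂ refl rewrite lower?-fromℕ n | y0↦N | lower?-fromℕ n | gN≡a | lower?-inject₁ a = refl
      ... | inj₁ (x , refl) rewrite lower?-inject₁ x with x == y0 in e
      ...   | true = sym (trans (cong (λ q → g (inject₁ q)) (==-true {i = x} {j = y0} e)) y0↦N)
      ...   | false with old↦old x (λ q → ==-false⇒≢ e (FP.inject₁-injective (trans q y≡y0)))
      ...     | u , gu rewrite gu | lower?-inject₁ u = refl

insert-Inj⁻ : ∀ {n} (u : Perm n) y → Inj (insert u y) → Inj u
insert-Inj⁻ {n} u y iw a b e with lastView y
... | inj₂ refl = FP.inject₁-injective (iw _ _ (trans (InsertNew.old↦old u a) (trans (cong inject₁ e) (sym (InsertNew.old↦old u b)))))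
... | inj₁ (y0 , refl) = lift-injective a b (iw (lift a) (lift b) (trans (step a) (trans (cong inject₁ e) (sym (step b)))))
  where
  -- y0 is represented by n, whose image is u(y0)
  lift : Fin n → Fin (suc n)
  lift x = if x == y0 then fromℕ n else inject₁ x
  step : ∀ x → app (insert u (inject₁ y0)) (lift x) ≡ inject₁ (app u x)
  step x with x == y0 in ex
  ... | true rewrite ==-true {i = x} {j = y0} ex = InsertAfter.new↦next u y0
  ... | false = InsertAfter.old↦old u y0 x (==-false⇒≢ ex)
  lift-injective : ∀ a b → lift a ≡ lift b → a ≡ b
  lift-injective a b hab with a == y0 in ea | b == y0 in eb
  ... | true | true = trans (==-true {i = a} {j = y0} ea) (sym (==-true {i = b} {j = y0} eb))
  ... | true | false = ⊥-elim (N≢inject₁ hab)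
  ... | false | true = ⊥-elim (inject₁≢N hab)
  ... | false | false = FP.inject₁-injective hab

delete-Inj : ∀ {n} (w : Perm (suc n)) (iw : Inj w) → Inj (delete w)
delete-Inj w iw = insert-Inj⁻ (delete w) (insertionPoint w iw) (subst Inj (sym (InsertDelete.insert-delete w iw)) iw)

∑Perm : ∀ n → (Perm n → ℕ) → ℕ
∑Perm n h = ∑ₗ (allWords n n) (λ v → χ (isPerm v) * h v)

#preimages : ∀ {n} → Perm (suc n) → ℕ
#preimages {n} w = ∑ₗ (allWords n n) (λ v → ∑ (suc n) (λ y → χ (isPerm v) * χ (vecEq w (insert v y))))

-- Each π ∈ S_{n+1} is insert v y for exactly one pair (v, y): namely
-- v = delete π and y = insertionPoint π.
uniquePreimage : ∀ {n} (w : Perm (suc n)) → Inj w → #preimages w ≡ 1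
uniquePreimage {n} w iw = begin
  ∑ₗ (allWords n n) (λ v → ∑ (suc n) (λ y → χ (isPerm v) * χ (vecEq w (insert v y))))
    ≡⟨ ∑ₗ-cong (allWords n n) (λ v → ∑-cong (suc n) (pointwise v)) ⟩
  ∑ₗ (allWords n n) (λ v → ∑ (suc n) (λ y → χ (vecEq v (delete w)) * (χ (y == y₀) * 1)))
    ≡⟨ ∑ₗ-cong (allWords n n) (λ v → trans (∑-*ˡ (suc n) (χ (vecEq v (delete w))) (λ y → χ (y == y₀) * 1))
                                          (cong (χ (vecEq v (delete w)) *_) (∑-δ (suc n) y₀ (λ _ → 1)))) ⟩
  ∑ₗ (allWords n n) (λ v → χ (vecEq v (delete w)) * 1)
    ≡⟨ allWords-δ n n (delete w) (λ _ → 1) ⟩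
  1 ∎
  where
  y₀ : Fin (suc n)
  y₀ = insertionPoint w iw
  pointwise : ∀ v y → χ (isPerm v) * χ (vecEq w (insert v y)) ≡ χ (vecEq v (delete w)) * (χ (y == y₀) * 1)
  pointwise v y with isPerm v in e
  ... | false with vecEq v (delete w) in e2
  ...   | false = refl
  ...   | true = ⊥-elim (f≢t (trans (sym e) (trans (cong isPerm (vecEq-true v (delete w) e2)) (Inj⇒isPerm (delete w) (delete-Inj w iw)))))
  pointwise v y | true with vecEq w (insert v y) in e3
  ... | true = sym (cong₂ (λ a b → χ a * (χ b * 1)) (trans (cong (vecEq v) v≡) (vecEq-refl v)) (trans (cong (y ==_) y≡) (==-refl y)))
    where
    w≡ : w ≡ insert v y
    w≡ = vecEq-true w (insert v y) e3
    v≡ : delete w ≡ v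
    v≡ = trans (cong delete w≡) (DeleteInsert.delete-insert v (isPerm⇒Inj v e) y)
    y≡ : y₀ ≡ y
    y≡ = Cycles.pred-uniq w iw (subst (λ u → app u y ≡ fromℕ n) (sym w≡) (DeleteInsert.y↦N v (isPerm⇒Inj v e) y))
  ... | false with vecEq v (delete w) in e4 | y == y₀ in e5
  ...   | false | _ = refl
  ...   | true | false = refl
  ...   | true | true = ⊥-elim (f≢t (trans (sym e3) (trans (cong (vecEq w) w≡) (vecEq-refl w))))
    where
    w≡ : insert v y ≡ w
    w≡ = trans (cong₂ insert (vecEq-true v (delete w) e4) (==-true {i = y} {j = y₀} e5)) (InsertDelete.insert-delete w iw)

-- The weight χ(v ∈ S_n)·h(insert v y), written as a sum over all words of length n+1:
-- insertion maps permutations to permutations.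
insert-weight : ∀ {n} (h : Perm (suc n) → ℕ) (v : Perm n) y →
  χ (isPerm v) * h (insert v y) ≡
  ∑ₗ (allWords (suc n) (suc n)) (λ w → χ (isPerm v) * χ (vecEq w (insert v y)) * (χ (isPerm w) * h w))
insert-weight {n} h v y = sym (begin
  ∑ₗ Sₙ₊₁ (λ w → χ (isPerm v) * χ (vecEq w (insert v y)) * (χ (isPerm w) * h w))
    ≡⟨ ∑ₗ-cong Sₙ₊₁ (λ w → NP.*-assoc (χ (isPerm v)) (χ (vecEq w (insert v y))) _) ⟩
  ∑ₗ Sₙ₊₁ (λ w → χ (isPerm v) * (χ (vecEq w (insert v y)) * (χ (isPerm w) * h w)))
    ≡⟨ ∑ₗ-*ˡ Sₙ₊₁ (χ (isPerm v)) _ ⟩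
  χ (isPerm v) * ∑ₗ Sₙ₊₁ (λ w → χ (vecEq w (insert v y)) * (χ (isPerm w) * h w))
    ≡⟨ cong (χ (isPerm v) *_) (allWords-δ (suc n) (suc n) (insert v y) (λ w → χ (isPerm w) * h w)) ⟩
  χ (isPerm v) * (χ (isPerm (insert v y)) * h (insert v y))
    ≡⟨ stillPerm (isPerm v) refl ⟩
  χ (isPerm v) * h (insert v y) ∎)
  where
  Sₙ₊₁ : List (Perm (suc n))
  Sₙ₊₁ = allWords (suc n) (suc n)
  stillPerm : ∀ b → isPerm v ≡ b → χ b * (χ (isPerm (insert v y)) * h (insert v y)) ≡ χ b * h (insert v y)
  stillPerm false _ = refl
  stillPerm true e rewrite Inj⇒isPerm (insert v y) (insert-Inj v (isPerm⇒Inj v e) y) = cong (λ z → z + 0) (NP.+-identityʳ _)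

preimage-weight : ∀ {n} (h : Perm (suc n) → ℕ) (w : Perm (suc n)) →
  ∑ₗ (allWords n n) (λ v → ∑ (suc n) (λ y → χ (isPerm v) * χ (vecEq w (insert v y)) * (χ (isPerm w) * h w)))
  ≡ χ (isPerm w) * h w
preimage-weight {n} h w = begin
  ∑ₗ Sₙ (λ v → ∑ (suc n) (λ y → χ (isPerm v) * χ (vecEq w (insert v y)) * (χ (isPerm w) * h w)))
    ≡⟨ ∑ₗ-cong Sₙ (λ v → ∑-*ʳ (suc n) (λ y → χ (isPerm v) * χ (vecEq w (insert v y))) (χ (isPerm w) * h w)) ⟩
  ∑ₗ Sₙ (λ v → ∑ (suc n) (λ y → χ (isPerm v) * χ (vecEq w (insert v y))) * (χ (isPerm w) * h w))
    ≡⟨ ∑ₗ-*ʳ Sₙ (λ v → ∑ (suc n) (λ y → χ (isPerm v) * χ (vecEq w (insert v y)))) (χ (isPerm w) * h w) ⟩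
  #preimages w * (χ (isPerm w) * h w)
    ≡⟨ once (isPerm w) refl ⟩
  χ (isPerm w) * h w ∎
  where
  Sₙ : List (Perm n)
  Sₙ = allWords n n
  once : ∀ b → isPerm w ≡ b → #preimages w * (χ b * h w) ≡ χ b * h w
  once false _ = NP.*-zeroʳ (#preimages w)
  once true e = trans (cong (_* (1 * h w)) (uniquePreimage w (isPerm⇒Inj w e))) (NP.*-identityˡ _)

∑Perm-insert : ∀ n (h : Perm (suc n) → ℕ) → ∑Perm (suc n) h ≡ ∑Perm n (λ v → ∑ (suc n) (λ y → h (insert v y)))
∑Perm-insert n h = sym (begin
  ∑ₗ Sₙ (λ v → χ (isPerm v) * ∑ (suc n) (λ y → h (insert v y)))
    ≡⟨ ∑ₗ-cong Sₙ (λ v → trans (sym (∑-*ˡ (suc n) (χ (isPerm v)) (λ y → h (insert v y)))) (∑-cong (suc n) (insert-weight h v))) ⟩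
  ∑ₗ Sₙ (λ v → ∑ (suc n) (λ y → ∑ₗ Sₙ₊₁ (λ w → F v y w)))
    ≡⟨ ∑ₗ-cong Sₙ (λ v → sym (∑ₗ-∑-swap Sₙ₊₁ (suc n) (λ w y → F v y w))) ⟩
  ∑ₗ Sₙ (λ v → ∑ₗ Sₙ₊₁ (λ w → ∑ (suc n) (λ y → F v y w)))
    ≡⟨ ∑ₗ-swap Sₙ Sₙ₊₁ (λ v w → ∑ (suc n) (λ y → F v y w)) ⟩
  ∑ₗ Sₙ₊₁ (λ w → ∑ₗ Sₙ (λ v → ∑ (suc n) (λ y → F v y w)))
    ≡⟨ ∑ₗ-cong Sₙ₊₁ (preimage-weight h) ⟩
  ∑ₗ Sₙ₊₁ (λ w → χ (isPerm w) * h w) ∎)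
  where
  Sₙ : List (Perm n)
  Sₙ = allWords n n
  Sₙ₊₁ : List (Perm (suc n))
  Sₙ₊₁ = allWords (suc n) (suc n)
  F : Perm n → Fin (suc n) → Perm (suc n) → ℕ
  F v y w = χ (isPerm v) * χ (vecEq w (insert v y)) * (χ (isPerm w) * h w)

-- The recurrence for countPerms

hasStats : ∀ {n} → Perm n → ℕ → ℕ → Bool
hasStats v k j = (crun v ≡ᵇ k) ∧ (cyc v ≡ᵇ j)

countPerms≡∑Perm : ∀ n k j → countPerms n k j ≡ ∑Perm n (λ v → χ (hasStats v k j))
countPerms≡∑Perm n k j = begin
  countPerms n k j
    ≡⟨ length-∑ₗ (filter (λ v → Data.Bool._≟_ (hasStats v k j) true) (perms n)) ⟩
  ∑ₗ (filter (λ v → Data.Bool._≟_ (hasStats v k j) true) (perms n)) (λ _ → 1)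
    ≡⟨ ∑ₗ-filter (λ v → hasStats v k j) (perms n) (λ _ → 1) ⟩
  ∑ₗ (perms n) (λ v → χ (hasStats v k j) * 1)
    ≡⟨ ∑ₗ-filter? _ (allWords n n) _ ⟩
  ∑ₗ (allWords n n) (λ v → χ (isPerm v) * (χ (hasStats v k j) * 1))
    ≡⟨ ∑ₗ-cong (allWords n n) (λ v → cong (χ (isPerm v) *_) (NP.*-identityʳ _)) ⟩
  ∑Perm n (λ v → χ (hasStats v k j)) ∎

∑Perm-+ : ∀ n (a b : Perm n → ℕ) → ∑Perm n (λ v → a v + b v) ≡ ∑Perm n a + ∑Perm n b
∑Perm-+ n a b = trans (∑ₗ-cong (allWords n n) (λ v → NP.*-distribˡ-+ (χ (isPerm v)) (a v) (b v))) (∑ₗ-+ (allWords n n) _ _)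

∑Perm-cong : ∀ n (a b : Perm n → ℕ) → (∀ v → Inj v → a v ≡ b v) → ∑Perm n a ≡ ∑Perm n b
∑Perm-cong n a b h = ∑ₗ-cong (allWords n n) pointwise
  where
  pointwise : ∀ v → χ (isPerm v) * a v ≡ χ (isPerm v) * b v
  pointwise v with isPerm v in e
  ... | false = refl
  ... | true = cong (λ z → z + 0) (h v (isPerm⇒Inj v e))

∑Perm-*ˡ : ∀ n c (a : Perm n → ℕ) → ∑Perm n (λ v → c * a v) ≡ c * ∑Perm n a
∑Perm-*ˡ n c a = trans (∑ₗ-cong (allWords n n) swap) (∑ₗ-*ˡ (allWords n n) c _)
  where
  swap : ∀ v → χ (isPerm v) * (c * a v) ≡ c * (χ (isPerm v) * a v)
  swap v = trans (sym (NP.*-assoc (χ (isPerm v)) c (a v)))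
                 (trans (cong (_* a v) (NP.*-comm (χ (isPerm v)) c)) (NP.*-assoc c (χ (isPerm v)) (a v)))

∑Perm-0 : ∀ n (a : Perm n → ℕ) → (∀ v → a v ≡ 0) → ∑Perm n a ≡ 0
∑Perm-0 n a h = trans (∑ₗ-cong (allWords n n) (λ v → trans (cong (χ (isPerm v) *_) (h v)) (NP.*-zeroʳ (χ (isPerm v)))))
                      (∑ₗ-0 (allWords n n))

-- The statistics of the n+1 insertions into one permutation v:
-- crun v of them keep (crun, cyc), n - crun v of them give (crun + 2, cyc),
-- and one gives (crun + 1, cyc + 1).
hasStats-Δ : ∀ (b : Bool) c k B → χ (((c + (if b then 0 else 2)) ≡ᵇ k) ∧ B) ≡
  χ b * χ ((c ≡ᵇ k) ∧ B) + χ (not b) * χ (((c + 2) ≡ᵇ k) ∧ B)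
hasStats-Δ true c k B rewrite NP.+-identityʳ c = sym (trans (NP.+-identityʳ _) (NP.+-identityʳ _))
hasStats-Δ false c k B = sym (NP.+-identityʳ _)

∑insert-hasStats : ∀ {n} (v : Perm n) → Inj v → ∀ k j →
  ∑ (suc n) (λ y → χ (hasStats (insert v y) k j)) ≡
  crun v * χ (hasStats v k j) + ((n ∸ crun v) * χ (((crun v + 2) ≡ᵇ k) ∧ (cyc v ≡ᵇ j))
                                 + χ ((suc (crun v) ≡ᵇ k) ∧ (suc (cyc v) ≡ᵇ j)))
∑insert-hasStats {n} v iv k j = begin
  ∑ (suc n) (λ y → χ (hasStats (insert v y) k j))
    ≡⟨ ∑-last n (λ y → χ (hasStats (insert v y) k j)) ⟩
  ∑ n (λ y0 → χ (hasStats (insert v (inject₁ y0)) k j)) + χ (hasStats (insert v (fromℕ n)) k j)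
    ≡⟨ cong₂ _+_ (∑-cong n after) newFixed ⟩
  ∑ n (λ y0 → χ (keeps y0) * X + χ (not (keeps y0)) * Y) + Z
    ≡⟨ cong (_+ Z) (∑-+ n _ _) ⟩
  ∑ n (λ y0 → χ (keeps y0) * X) + ∑ n (λ y0 → χ (not (keeps y0)) * Y) + Z
    ≡⟨ cong (_+ Z) (cong₂ _+_ (trans (∑-*ʳ n _ X) (cong (_* X) Vc.∑keeps≡crun))
                              (trans (∑-*ʳ n _ Y) (cong (_* Y) Vc.∑notKeeps≡n∸crun))) ⟩
  crun v * X + (n ∸ crun v) * Y + Z
    ≡⟨ NP.+-assoc (crun v * X) _ Z ⟩
  crun v * X + ((n ∸ crun v) * Y + Z) ∎
  where
  module Vc = RunStatistics v iv
  keeps : Fin n → Bool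
  keeps = Vc.keeps
  X : ℕ
  X = χ (hasStats v k j)
  Y : ℕ
  Y = χ (((crun v + 2) ≡ᵇ k) ∧ (cyc v ≡ᵇ j))
  Z : ℕ
  Z = χ ((suc (crun v) ≡ᵇ k) ∧ (suc (cyc v) ≡ᵇ j))
  newFixed : χ (hasStats (insert v (fromℕ n)) k j) ≡ Z
  newFixed = cong₂ (λ a b → χ ((a ≡ᵇ k) ∧ (b ≡ᵇ j)))
    (InsertionEffect.NewFixedPoint.crun-newFixed v iv (fromℕ n) refl)
    (InsertionEffect.NewFixedPoint.cyc-newFixed v iv (fromℕ n) refl)
  after : ∀ y0 → χ (hasStats (insert v (inject₁ y0)) k j) ≡ χ (keeps y0) * X + χ (not (keeps y0)) * Y
  after y0 = trans (cong₂ (λ a b → χ ((a ≡ᵇ k) ∧ (b ≡ᵇ j)))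
                     (InsertionEffect.AfterOld.crun-after v iv (inject₁ y0) y0 refl)
                     (InsertionEffect.AfterOld.cyc-after v iv (inject₁ y0) y0 refl))
                   (hasStats-Δ (keeps y0) (crun v) k (cyc v ≡ᵇ j))

-- The counts behind the terms q·R_{n,k-1} and (n-k+2)·R_{n,k-2} of the recurrence.
qTermCount : ℕ → ℕ → ℕ → ℕ
qTermCount n zero j = 0
qTermCount n (suc k) zero = 0
qTermCount n (suc k) (suc j) = countPerms n k j

lastTermCount : ℕ → ℕ → ℕ → ℕ
lastTermCount n zero j = 0
lastTermCount n (suc zero) j = 0
lastTermCount n (suc (suc k)) j = (n ∸ k) * countPerms n k j

∑Perm-keep : ∀ n k j → ∑Perm n (λ v → crun v * χ (hasStats v k j)) ≡ k * countPerms n k j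
∑Perm-keep n k j = trans (∑Perm-cong n _ _ (λ v _ → onStats v (crun v ≡ᵇ k) refl))
                         (trans (∑Perm-*ˡ n k _) (cong (k *_) (sym (countPerms≡∑Perm n k j))))
  where
  onStats : ∀ v b → (crun v ≡ᵇ k) ≡ b → crun v * χ (b ∧ (cyc v ≡ᵇ j)) ≡ k * χ (b ∧ (cyc v ≡ᵇ j))
  onStats v true e = cong (_* χ (cyc v ≡ᵇ j)) (≡ᵇ-true⇒ {crun v} {k} e)
  onStats v false _ = trans (NP.*-zeroʳ (crun v)) (sym (NP.*-zeroʳ k))

∑Perm-grow : ∀ n k j → ∑Perm n (λ v → (n ∸ crun v) * χ (((crun v + 2) ≡ᵇ k) ∧ (cyc v ≡ᵇ j))) ≡ lastTermCount n k j
∑Perm-grow n zero j = ∑Perm-0 n _ (λ v → trans (cong (λ z → (n ∸ crun v) * χ ((z ≡ᵇ 0) ∧ (cyc v ≡ᵇ j))) (NP.+-comm (crun v) 2))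
                                               (NP.*-zeroʳ (n ∸ crun v)))
∑Perm-grow n (suc zero) j = ∑Perm-0 n _ (λ v → trans (cong (λ z → (n ∸ crun v) * χ ((z ≡ᵇ 1) ∧ (cyc v ≡ᵇ j))) (NP.+-comm (crun v) 2))
                                                     (NP.*-zeroʳ (n ∸ crun v)))
∑Perm-grow n (suc (suc k)) j = trans (∑Perm-cong n _ _ (λ v _ → onStats v))
                                     (trans (∑Perm-*ˡ n (n ∸ k) _) (cong ((n ∸ k) *_) (sym (countPerms≡∑Perm n k j))))
  where
  onStats : ∀ v → (n ∸ crun v) * χ (((crun v + 2) ≡ᵇ suc (suc k)) ∧ (cyc v ≡ᵇ j)) ≡ (n ∸ k) * χ (hasStats v k j)
  onStats v rewrite NP.+-comm (crun v) 2 with crun v ≡ᵇ k in e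
  ... | true = cong (λ z → (n ∸ z) * χ (cyc v ≡ᵇ j)) (≡ᵇ-true⇒ {crun v} {k} e)
  ... | false = trans (NP.*-zeroʳ (n ∸ crun v)) (sym (NP.*-zeroʳ (n ∸ k)))

∑Perm-newFixed : ∀ n k j → ∑Perm n (λ v → χ ((suc (crun v) ≡ᵇ k) ∧ (suc (cyc v) ≡ᵇ j))) ≡ qTermCount n k j
∑Perm-newFixed n zero j = ∑Perm-0 n _ (λ v → refl)
∑Perm-newFixed n (suc k) zero = ∑Perm-0 n _ (λ v → cong χ (∧-zeroʳ (crun v ≡ᵇ k)))
∑Perm-newFixed n (suc k) (suc j) = sym (countPerms≡∑Perm n k j)

countPerms-recurrence : ∀ n k j →
  countPerms (suc n) k j ≡ k * countPerms n k j + qTermCount n k j + lastTermCount n k j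
countPerms-recurrence n k j = begin
  countPerms (suc n) k j                                          ≡⟨ countPerms≡∑Perm (suc n) k j ⟩
  ∑Perm (suc n) (λ w → χ (hasStats w k j))                        ≡⟨ ∑Perm-insert n (λ w → χ (hasStats w k j)) ⟩
  ∑Perm n (λ v → ∑ (suc n) (λ y → χ (hasStats (insert v y) k j))) ≡⟨ ∑Perm-cong n _ _ (λ v iv → ∑insert-hasStats v iv k j) ⟩
  ∑Perm n (λ v → A v + (B v + C v))                               ≡⟨ ∑Perm-+ n A (λ v → B v + C v) ⟩
  ∑Perm n A + ∑Perm n (λ v → B v + C v)                           ≡⟨ cong (∑Perm n A +_) (∑Perm-+ n B C) ⟩
  ∑Perm n A + (∑Perm n B + ∑Perm n C)                             ≡⟨ cong₂ _+_ (∑Perm-keep n k j) (cong₂ _+_ (∑Perm-grow n k j) (∑Perm-newFixed n k j)) ⟩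
  k * countPerms n k j + (lastTermCount n k j + qTermCount n k j) ≡⟨ cong (k * countPerms n k j +_) (NP.+-comm (lastTermCount n k j) _) ⟩
  k * countPerms n k j + (qTermCount n k j + lastTermCount n k j) ≡⟨ sym (NP.+-assoc (k * countPerms n k j) _ _) ⟩
  k * countPerms n k j + qTermCount n k j + lastTermCount n k j   ∎
  where
  A B C : Perm n → ℕ
  A v = crun v * χ (hasStats v k j)
  B v = (n ∸ crun v) * χ (((crun v + 2) ≡ᵇ k) ∧ (cyc v ≡ᵇ j))
  C v = χ ((suc (crun v) ≡ᵇ k) ∧ (suc (cyc v) ≡ᵇ j))

-- No permutation of [n] has more than n cycle runs.
countPerms-vanishes : ∀ n k j → n < k → countPerms n k j ≡ 0
countPerms-vanishes n k j n<k =
  trans (countPerms≡∑Perm n k j) (trans (∑Perm-cong n _ (λ _ → 0) noneAbove) (∑Perm-0 n _ (λ _ → refl)))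
  where
  noneAbove : ∀ v → Inj v → χ (hasStats v k j) ≡ 0
  noneAbove v iv rewrite ≡ᵇ-false {crun v} {k} (λ q → NP.<⇒≱ n<k (subst (_≤ n) q (RunStatistics.crun≤n v iv))) = refl

open import Data.Integer as ℤ using (ℤ; +_)
import Data.Integer.Properties as ℤP
open import Data.Integer.Tactic.RingSolver using (solve-∀)

lastCoefficient : ∀ n k → k ≤ n → (+ n) ℤ.- (+ suc (suc k)) ℤ.+ (+ 2) ≡ + (n ∸ k)
lastCoefficient n k k≤n = begin
  (+ n) ℤ.- (+ suc (suc k)) ℤ.+ (+ 2)
    ≡⟨ cong₂ (λ a b → a ℤ.- b ℤ.+ + 2)
         (trans (cong +_ (sym (NP.m∸n+n≡m k≤n))) (ℤP.pos-+ (n ∸ k) k))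
         (trans (cong +_ (NP.+-comm 2 k)) (ℤP.pos-+ k 2)) ⟩
  (+ (n ∸ k) ℤ.+ + k) ℤ.- (+ k ℤ.+ + 2) ℤ.+ + 2
    ≡⟨ cancel (+ (n ∸ k)) (+ k) ⟩
  + (n ∸ k) ∎
  where
  cancel : ∀ (a k : ℤ) → (a ℤ.+ k) ℤ.- (k ℤ.+ + 2) ℤ.+ + 2 ≡ a
  cancel = solve-∀

qTerm≡count : ∀ n k j → (∀ k j → R n k j ≡ + countPerms n k j) → qTerm n k j ≡ + qTermCount n k j
qTerm≡count n zero j ih = refl
qTerm≡count n (suc k) zero ih = refl
qTerm≡count n (suc k) (suc j) ih = ih k j

lastTerm≡count : ∀ n k j → (∀ k j → R n k j ≡ + countPerms n k j) → lastTerm n k j ≡ + lastTermCount n k j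
lastTerm≡count n zero j ih = refl
lastTerm≡count n (suc zero) j ih = refl
lastTerm≡count n (suc (suc k)) j ih rewrite ih k j with NP.≤-<-connex k n
... | inj₁ k≤n = trans (cong (ℤ._* + countPerms n k j) (lastCoefficient n k k≤n)) (sym (ℤP.pos-* (n ∸ k) _))
... | inj₂ n<k rewrite countPerms-vanishes n k j n<k =
  trans (ℤP.*-zeroʳ ((+ n) ℤ.- (+ suc (suc k)) ℤ.+ (+ 2))) (cong +_ (sym (NP.*-zeroʳ (n ∸ k))))

+-recurrence : ∀ k a b c → (+ k) ℤ.* (+ a) ℤ.+ (+ b) ℤ.+ (+ c) ≡ + (k * a + b + c)
+-recurrence k a b c = begin
  (+ k) ℤ.* (+ a) ℤ.+ (+ b) ℤ.+ (+ c) ≡⟨ cong (λ z → z ℤ.+ (+ b) ℤ.+ (+ c)) (sym (ℤP.pos-* k a)) ⟩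
  + (k * a) ℤ.+ (+ b) ℤ.+ (+ c)       ≡⟨ cong (ℤ._+ (+ c)) (sym (ℤP.pos-+ (k * a) b)) ⟩
  + (k * a + b) ℤ.+ (+ c)             ≡⟨ sym (ℤP.pos-+ (k * a + b) c) ⟩
  + (k * a + b + c)                   ∎

R≡countPerms : ∀ n k j → R n k j ≡ + countPerms n k j
R≡countPerms zero zero zero = refl
R≡countPerms zero zero (suc j) = refl
R≡countPerms zero (suc k) j = refl
R≡countPerms (suc n) k j = begin
  (+ k) ℤ.* R n k j ℤ.+ qTerm n k j ℤ.+ lastTerm n k j
    ≡⟨ cong₂ ℤ._+_ (cong₂ ℤ._+_ (cong ((+ k) ℤ.*_) (R≡countPerms n k j)) (qTerm≡count n k j (R≡countPerms n)))
                   (lastTerm≡count n k j (R≡countPerms n)) ⟩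
  (+ k) ℤ.* (+ countPerms n k j) ℤ.+ (+ qTermCount n k j) ℤ.+ (+ lastTermCount n k j)
    ≡⟨ +-recurrence k (countPerms n k j) (qTermCount n k j) (lastTermCount n k j) ⟩
  + (k * countPerms n k j + qTermCount n k j + lastTermCount n k j)
    ≡⟨ cong +_ (sym (countPerms-recurrence n k j)) ⟩
  + countPerms (suc n) k j ∎

-- Theorem.  For n ≥ 1, [x^k q^j] R_n(x;q) = #{π ∈ S_n : crun π = k, cyc π = j}
-- (the identity holds for n = 0 as well).
mainTheorem5 : (n : ℕ) → n ≥ 1 → (k j : ℕ) → R n k j ≡ + countPerms n k j
mainTheorem5 n _ k j = R≡countPerms n k j
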